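{- Let $\mathcal{S}\subset\omega_4$ be a Segre variety $\mathcal{S}_3(2)$ and $\mathcal{F}$ a fan for $\mathcal{S}$. (i) $\mathcal{F}$ can be expressed uniquely as a union $\mathcal{F}=t\cup t'\cup t''$ of a triplet of troikas. (ii) The three troikas $t,t',t''$ have the same centre, denoted $c_{\mathcal{F}}$. (iii) $\mathcal{F}$ determines uniquely a triplet $\mathcal{T}=\{\mathcal{F},\mathcal{F}',\mathcal{F}''\}$ of fans of $\mathcal{S}$ such that $\mathcal{F}\cup\mathcal{F}'\cup\mathcal{F}''=\mathcal{S}$; moreover $L(\mathcal{T}):=\{c_{\mathcal{F}},c_{\mathcal{F}'},c_{\mathcal{F}''}\}$ is one of the four lines $\mathbb{P}V_a,\mathbb{P}V_b,\mathbb{P}V_c,\mathbb{P}V_d$.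
   Context: Work over $\mathbb{F}_2$. $V_8=V(8,2)$ with basis $e_1,\dots,e_8$, $V_a=\langle e_1,e_8\rangle$, $V_b=\langle e_2,e_7\rangle$, $V_c=\langle e_3,e_6\rangle$, $V_d=\langle e_4,e_5\rangle$; points of $\operatorname{PG}(7,2)$ are nonzero vectors; $\omega_4$ is the set of vectors all four of whose components in $V_a,\dots,V_d$ are nonzero. Let $\zeta_a: e_1\mapsto e_8\mapsto e_1+e_8\mapsto e_1$, $\zeta_b: e_7\mapsto e_2\mapsto e_2+e_7\mapsto e_7$, $\zeta_c: e_3\mapsto e_6\mapsto e_3+e_6\mapsto e_3$, $\zeta_d: e_5\mapsto e_4\mapsto e_4+e_5\mapsto e_5$; for $\lambda=ijkl\in\mathbb{F}_3^4$, $A_\lambda=\zeta_a^i\oplus\zeta_b^j\oplus\zeta_c^k\oplus\zeta_d^l$; $u=e_1+\dots+e_8$; $p_\lambda=A_\lambda u$, so $\lambda\mapsto p_\lambda$ is a bijection $\mathbb{F}_3^4\to\omega_4$. A Segre variety $\mathcal{S}_3(2)$ is the image under a linear isomorphism $\phi:V(2,2)^{\otimes3}\to V_8$ of the nonzero pure tensors; its generators are the $27$ lines obtained by letting one tensor factor vary over the nonzero vectors with the other two fixed. A fan of $\mathcal{S}$ is a $9$-subset of $\mathcal{S}$ no two of whose points lie on a common generator. The Hamming distance of points of $\omega_4$ is $\operatorname{hd}(p_\rho,p_\sigma)=\operatorname{wt}_\Xi(\rho-\sigma)$, the number of nonzero coordinates of $\rho-\sigma$ in the basis $\{\beta,\gamma,\delta,\alpha\}=\{1221,2121,2211,1111\}$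 of $\mathbb{F}_3^4$. A troika on $\mathcal{S}$ is a set of three points of $\mathcal{S}$ pairwise at Hamming distance $3$; its centre is the vector sum $c(t)=p_1+p_2+p_3$. -}

module Defs where

open import Level using (0ℓ)
open import Data.Bool using (Bool; true; false; _xor_; _∧_; _∨_)
open import Data.Nat using (ℕ; zero; suc; _+_)
open import Data.Fin using (Fin; zero; suc; toℕ)
open import Data.Vec using (Vec; []; _∷_; lookup; zipWith; replicate; tabulate)
import Data.Vec
open import Data.List using (List; length)
open import Data.List.Relation.Unary.Unique.Propositional using (Unique)
open import Data.List.Membership.Propositional renaming (_∈_ to _∈ₗ_)
open import Data.Product using (Σ; Σ-syntax; ∃; ∃-syntax; _×_; _,_)
open import Data.Sum using (_⊎_)
open import Relation.Binary.PropositionalEquality using (_≡_; _≢_)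
open import Relation.Nullary using (¬_)
open import Relation.Unary using (Pred; _⊆_; _≐_; _∪_)
open import Function.Bundles using (_⇔_)
open import Function.Definitions using (Bijective)

-- 𝔽₂ = Bool (addition = xor, multiplication = ∧).
-- V₈ = 𝔽₂⁸; position i (0-based) holds the coefficient of e_{i+1}.

V8 : Set
V8 = Vec Bool 8

_⊕_ : V8 → V8 → V8
_⊕_ = zipWith _xor_

0v : V8
0v = replicate 8 false

-- Subsets of V₈ (points of PG(7,2) are the nonzero vectors).
Subset8 : Set₁
Subset8 = Pred V8 0ℓ

HasSize : Subset8 → ℕ → Set
HasSize A n = Σ[ xs ∈ List V8 ] (Unique xs × length xs ≡ n × (∀ v → (v ∈ₗ xs) ⇔ A v))

set3 : V8 → V8 → V8 → Subset8
set3 p q r v = v ≡ p ⊎ v ≡ q ⊎ v ≡ r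

InTriple : Subset8 → Subset8 → Subset8 → Subset8 → Set
InTriple X A₁ A₂ A₃ = X ≐ A₁ ⊎ X ≐ A₂ ⊎ X ≐ A₃

SameTriple : Subset8 → Subset8 → Subset8 → Subset8 → Subset8 → Subset8 → Set
SameTriple A₁ A₂ A₃ B₁ B₂ B₃ =
  (InTriple A₁ B₁ B₂ B₃ × InTriple A₂ B₁ B₂ B₃ × InTriple A₃ B₁ B₂ B₃) ×
  (InTriple B₁ A₁ A₂ A₃ × InTriple B₂ A₁ A₂ A₃ × InTriple B₃ A₁ A₂ A₃)

-- The subspaces V_a = ⟨e₁,e₈⟩, V_b = ⟨e₂,e₇⟩, V_c = ⟨e₃,e₆⟩, V_d = ⟨e₄,e₅⟩

nz2 : Bool → Bool → Set
nz2 x y = (x ∨ y) ≡ true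

ω4 : Subset8
ω4 (x1 ∷ x2 ∷ x3 ∷ x4 ∷ x5 ∷ x6 ∷ x7 ∷ x8 ∷ []) =
  nz2 x1 x8 × nz2 x2 x7 × nz2 x3 x6 × nz2 x4 x5

PVa PVb PVc PVd : Subset8
PVa (x1 ∷ x2 ∷ x3 ∷ x4 ∷ x5 ∷ x6 ∷ x7 ∷ x8 ∷ []) =
  nz2 x1 x8 × x2 ≡ false × x3 ≡ false × x4 ≡ false × x5 ≡ false × x6 ≡ false × x7 ≡ false
PVb (x1 ∷ x2 ∷ x3 ∷ x4 ∷ x5 ∷ x6 ∷ x7 ∷ x8 ∷ []) =
  nz2 x2 x7 × x1 ≡ false × x3 ≡ false × x4 ≡ false × x5 ≡ false × x6 ≡ false × x8 ≡ false
PVc (x1 ∷ x2 ∷ x3 ∷ x4 ∷ x5 ∷ x6 ∷ x7 ∷ x8 ∷ []) =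
  nz2 x3 x6 × x1 ≡ false × x2 ≡ false × x4 ≡ false × x5 ≡ false × x7 ≡ false × x8 ≡ false
PVd (x1 ∷ x2 ∷ x3 ∷ x4 ∷ x5 ∷ x6 ∷ x7 ∷ x8 ∷ []) =
  nz2 x4 x5 × x1 ≡ false × x2 ≡ false × x3 ≡ false × x6 ≡ false × x7 ≡ false × x8 ≡ false

-- The maps ζ on the 2-dimensional components, in coordinates
-- (coefficient of the lower-index basis vector, coefficient of the higher one).

Pair : Set
Pair = Bool × Bool

-- ζ_a : e₁ ↦ e₈ ↦ e₁+e₈ ↦ e₁   on (x₁,x₈)
ζa : Pair → Pair
ζa (x1 , x8) = (x8 , x1 xor x8)
-- ζ_b : e₇ ↦ e₂ ↦ e₂+e₇ ↦ e₇   on (x₂,x₇)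
ζb : Pair → Pair
ζb (x2 , x7) = (x2 xor x7 , x2)
-- ζ_c : e₃ ↦ e₆ ↦ e₃+e₆ ↦ e₃   on (x₃,x₆)
ζc : Pair → Pair
ζc (x3 , x6) = (x6 , x3 xor x6)
-- ζ_d : e₅ ↦ e₄ ↦ e₄+e₅ ↦ e₅   on (x₄,x₅)
ζd : Pair → Pair
ζd (x4 , x5) = (x4 xor x5 , x4)

iter : ℕ → (Pair → Pair) → Pair → Pair
iter zero    f x = x
iter (suc n) f x = f (iter n f x)

-- 𝔽₃ = Fin 3, and 𝔽₃⁴ with λ = ijkl written i ∷ j ∷ k ∷ l ∷ []
F3 : Set
F3 = Fin 3

F34 : Set
F34 = Vec F3 4

-- A_λ = ζ_a^i ⊕ ζ_b^j ⊕ ζ_c^k ⊕ ζ_d^l acting on V₈ = V_a ⊕ V_b ⊕ V_c ⊕ V_d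
A : F34 → V8 → V8
A (i ∷ j ∷ k ∷ l ∷ []) (x1 ∷ x2 ∷ x3 ∷ x4 ∷ x5 ∷ x6 ∷ x7 ∷ x8 ∷ [])
  with iter (toℕ i) ζa (x1 , x8) | iter (toℕ j) ζb (x2 , x7)
     | iter (toℕ k) ζc (x3 , x6) | iter (toℕ l) ζd (x4 , x5)
... | (y1 , y8) | (y2 , y7) | (y3 , y6) | (y4 , y5) =
  y1 ∷ y2 ∷ y3 ∷ y4 ∷ y5 ∷ y6 ∷ y7 ∷ y8 ∷ []

u : V8
u = replicate 8 true

p : F34 → V8
p λ′ = A λ′ u

_+₃_ : F3 → F3 → F3
zero +₃ y = y
suc zero +₃ zero = suc zero
suc zero +₃ suc zero = suc (suc zero)
suc zero +₃ suc (suc zero) = zero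
suc (suc zero) +₃ zero = suc (suc zero)
suc (suc zero) +₃ suc zero = zero
suc (suc zero) +₃ suc (suc zero) = suc zero

-₃_ : F3 → F3
-₃ zero = zero
-₃ suc zero = suc (suc zero)
-₃ suc (suc zero) = suc zero

_*₃_ : F3 → F3 → F3
zero *₃ y = zero
suc zero *₃ y = y
suc (suc zero) *₃ y = -₃ y

_+v_ : F34 → F34 → F34
_+v_ = zipWith _+₃_

_-v_ : F34 → F34 → F34
x -v y = zipWith (λ a b → a +₃ (-₃ b)) x y

_·v_ : F3 → F34 → F34
c ·v x = Data.Vec.map (c *₃_) x

one two : F3
one = suc zero
two = suc (suc zero)

β γ δ α : F34
β = one ∷ two ∷ two ∷ one ∷ []
γ = two ∷ one ∷ two ∷ one ∷ []
δ = two ∷ two ∷ one ∷ one ∷ []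
α = one ∷ one ∷ one ∷ one ∷ []

fromΞ : F34 → F34
fromΞ (c1 ∷ c2 ∷ c3 ∷ c4 ∷ []) =
  (c1 ·v β) +v ((c2 ·v γ) +v ((c3 ·v δ) +v (c4 ·v α)))

nzCount : ∀ {n} → Vec F3 n → ℕ
nzCount [] = 0
nzCount (zero ∷ xs) = nzCount xs
nzCount (suc _ ∷ xs) = suc (nzCount xs)

-- wt_Ξ(μ) = k : the Ξ-coordinate vector of μ has exactly k nonzero entries
-- (Ξ is a basis, so the coordinate vector is unique)
WtΞ : F34 → ℕ → Set
WtΞ μ k = Σ[ c ∈ F34 ] (fromΞ c ≡ μ × nzCount c ≡ k)

-- hd(p_ρ, p_σ) = wt_Ξ(ρ - σ) = k
HD : V8 → V8 → ℕ → Set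
HD x y k = Σ[ ρ ∈ F34 ] Σ[ σ ∈ F34 ] (x ≡ p ρ × y ≡ p σ × WtΞ (ρ -v σ) k)

-- V(2,2)^{⊗3}, with coordinates indexed by (i,j,k) ∈ Fin 2 × Fin 2 × Fin 2

V2 : Set
V2 = Vec Bool 2

Tensor : Set
Tensor = Vec (Vec (Vec Bool 2) 2) 2

_⊞_ : Tensor → Tensor → Tensor
_⊞_ = zipWith (zipWith (zipWith _xor_))

0t : Tensor
0t = replicate 2 (replicate 2 (replicate 2 false))

0₂ : V2
0₂ = false ∷ false ∷ []

_⊗_⊗_ : V2 → V2 → V2 → Tensor
x ⊗ y ⊗ z = tabulate λ i → tabulate λ j → tabulate λ k →
  lookup x i ∧ lookup y j ∧ lookup z k

-- 𝔽₂-linearity (over 𝔽₂ additivity is linearity)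
Linear : (Tensor → V8) → Set
Linear φ = ∀ S T → φ (S ⊞ T) ≡ φ S ⊕ φ T

LinIso : (Tensor → V8) → Set
LinIso φ = Linear φ × Bijective _≡_ _≡_ φ

Segre : (Tensor → V8) → Subset8
Segre φ v = Σ[ T ∈ Tensor ]
  ((Σ[ x ∈ V2 ] Σ[ y ∈ V2 ] Σ[ z ∈ V2 ] T ≡ x ⊗ y ⊗ z) × T ≢ 0t × v ≡ φ T)

Generator : (Tensor → V8) → Subset8 → Set
Generator φ g = Σ[ y ∈ V2 ] Σ[ z ∈ V2 ] (y ≢ 0₂ × z ≢ 0₂ ×
  ( (g ≐ λ v → Σ[ x ∈ V2 ] (x ≢ 0₂ × v ≡ φ (x ⊗ y ⊗ z)))
  ⊎ (g ≐ λ v → Σ[ x ∈ V2 ] (x ≢ 0₂ × v ≡ φ (y ⊗ x ⊗ z)))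
  ⊎ (g ≐ λ v → Σ[ x ∈ V2 ] (x ≢ 0₂ × v ≡ φ (y ⊗ z ⊗ x)))))

OnCommonGenerator : (Tensor → V8) → V8 → V8 → Set₁
OnCommonGenerator φ a b = Σ[ g ∈ Subset8 ] (Generator φ g × g a × g b)

Fan : (Tensor → V8) → Subset8 → Set₁
Fan φ F = F ⊆ Segre φ × HasSize F 9 ×
  (∀ a b → F a → F b → a ≢ b → ¬ OnCommonGenerator φ a b)

Troika : (Tensor → V8) → Subset8 → Set
Troika φ t = t ⊆ Segre φ × HasSize t 3 × (∀ a b → t a → t b → a ≢ b → HD a b 3)

IsCentre : Subset8 → V8 → Set
IsCentre t c = Σ[ p1 ∈ V8 ] Σ[ p2 ∈ V8 ] Σ[ p3 ∈ V8 ]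
  (p1 ≢ p2 × p1 ≢ p3 × p2 ≢ p3 × t ≐ set3 p1 p2 p3 × c ≡ (p1 ⊕ p2) ⊕ p3)

TroikaSplit : (Tensor → V8) → Subset8 → Subset8 → Subset8 → Subset8 → Set
TroikaSplit φ F t t′ t″ = Troika φ t × Troika φ t′ × Troika φ t″ × F ≐ (t ∪ (t′ ∪ t″))

FanCentre : (Tensor → V8) → Subset8 → V8 → Set₁
FanCentre φ F c = Σ[ t ∈ Subset8 ] Σ[ t′ ∈ Subset8 ] Σ[ t″ ∈ Subset8 ]
  (TroikaSplit φ F t t′ t″ × IsCentre t c × IsCentre t′ c × IsCentre t″ c)

-- Labelling the three nonzero vectors of V(2,2) by 𝔽₃ identifies the pure tensors with the grid
-- 𝔽₃³, and λ ↦ p_λ identifies ω₄ with 𝔽₃⁴. Every component of φ is linear and nowhere zero on pure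
-- tensors, which forces its label to be an affine function r_i · g + k_i with coefficients ±1; the
-- four forms r_i are pairwise non-proportional because φ is onto. Hamming distance on 𝒮 thus becomes
-- wt_Ξ (E (g − h)) for the sign matrix E with rows r_i. A fan meets every vertical line of the grid
-- once, so it is the graph of a Latin square of order 3, that is an affine plane c = ± a ± b + C.
-- Its troikas are exactly its three lines in the unique direction of the plane along which E has
-- weight 3, and the three points of such a line add up to a vector supported on the component V_x
-- whose row r_x vanishes on the plane, with a value depending only on C. The parallel planes C + 1
-- and C + 2 are the only fans completing the fan to 𝒮, and the three centres run through ℙV_x.
-- The remaining finite facts are checked by exhaustive search.

module Submission where

open import Defs
open import Level using (0ℓ)
open import Data.Bool using (Bool; true; false; T; T?; _xor_; _∧_; _∨_; not; if_then_else_)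
import Data.Bool.Properties as Boolₚ
open import Data.Empty using (⊥; ⊥-elim)
open import Data.Fin using (Fin; zero; suc)
import Data.Fin.Properties as Finₚ
open import Data.List using (List; []; _∷_; map; foldr; length; allFin; cartesianProduct; concatMap; filter)
open import Data.List.Membership.Propositional using (_∈_)
open import Data.List.Membership.Propositional.Properties
  using (∈-allFin; ∈-cartesianProduct⁺; ∈-map⁺; ∈-map⁻; ∈-filter⁺)
open import Data.List.Properties using (length-map)
import Data.List.Properties
import Data.List.Membership.DecPropositional
open import Data.List.Relation.Binary.Subset.Propositional using () renaming (_⊆_ to _⊆ₗ_)
import Data.List.Relation.Unary.All as All
open import Data.List.Relation.Unary.All using (All; []; _∷_)
open import Data.List.Relation.Unary.Any using (here; there)
open import Data.List.Relation.Unary.AllPairs using (AllPairs; []; _∷_)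
import Data.List.Relation.Unary.AllPairs as AllPairs
import Data.List.Relation.Unary.AllPairs.Properties as AllPairsₚ
open import Data.List.Relation.Unary.Unique.Propositional using (Unique)
import Data.List.Relation.Unary.Unique.Propositional.Properties as Uniqueₚ
open import Data.Nat using (ℕ; zero; suc; _≤_; z≤n; s≤s)
import Data.Nat
import Data.Nat.Properties as ℕₚ
open import Data.Product using (Σ; Σ-syntax; _×_; _,_; proj₁; proj₂)
import Data.Product.Properties as Productₚ
open import Data.Sum using (_⊎_; inj₁; inj₂)
open import Data.Vec using (Vec; []; _∷_; lookup; tabulate)
import Data.Vec.Properties as Vecₚ
open import Function using (_∘_)
open import Function.Bundles using (_⇔_; mk⇔; Equivalence)
open import Function.Definitions using (Bijective)
open import Relation.Binary.PropositionalEquality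
  using (_≡_; _≢_; refl; sym; trans; cong; cong₂; subst; subst₂; module ≡-Reasoning)
open import Relation.Nullary using (Dec; yes; no; ¬_)
open import Relation.Nullary.Decidable using (from-yes; map′; _×-dec_; _⊎-dec_; _→-dec_; ¬?)
open import Relation.Unary using (Pred; Decidable; _⊆_; _≐_; _∪_)
open import Relation.Unary.Properties using (≐-refl; ≐-sym; ≐-trans)

-- Exhaustive search over finite types

record Exhaustible (X : Set) : Set₁ where
  field
    ∀? : {P : Pred X 0ℓ} → Decidable P → Dec (∀ x → P x)
    ∃? : {P : Pred X 0ℓ} → Decidable P → Dec (Σ X P)

open Exhaustible {{...}} public

instance
  Bool-exhaustible : Exhaustible Bool
  Bool-exhaustible = record
    { ∀? = λ P? → map′ (λ (pf , pt) → λ { false → pf ; true → pt }) (λ h → h false , h true)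
                       (P? false ×-dec P? true)
    ; ∃? = λ P? → map′ (λ { (inj₁ pf) → false , pf ; (inj₂ pt) → true , pt })
                       (λ { (false , pf) → inj₁ pf ; (true , pt) → inj₂ pt })
                       (P? false ⊎-dec P? true) }

  Fin-exhaustible : ∀ {n} → Exhaustible (Fin n)
  Fin-exhaustible = record { ∀? = Finₚ.all? ; ∃? = Finₚ.any? }

  ×-exhaustible : {X Y : Set} {{_ : Exhaustible X}} {{_ : Exhaustible Y}} → Exhaustible (X × Y)
  ×-exhaustible = record
    { ∀? = λ P? → map′ (λ h (x , y) → h x y) (λ h x y → h (x , y)) (∀? λ x → ∀? λ y → P? (x , y))
    ; ∃? = λ P? → map′ (λ (x , y , pxy) → (x , y) , pxy) (λ ((x , y) , pxy) → x , y , pxy)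
                       (∃? λ x → ∃? λ y → P? (x , y)) }

  Vec-exhaustible : {X : Set} {{_ : Exhaustible X}} {n : ℕ} → Exhaustible (Vec X n)
  Vec-exhaustible {X} {n} = vectors n
    where
    vectors : ∀ n → Exhaustible (Vec X n)
    vectors zero = record
      { ∀? = λ P? → map′ (λ { p [] → p }) (λ h → h []) (P? [])
      ; ∃? = λ P? → map′ ([] ,_) (λ { ([] , p) → p }) (P? []) }
    vectors (suc n) = record
      { ∀? = λ P? → map′ (λ { h (x ∷ v) → h x v }) (λ h x v → h (x ∷ v))
                         (∀? λ x → Exhaustible.∀? (vectors n) λ v → P? (x ∷ v))
      ; ∃? = λ P? → map′ (λ (x , v , p) → x ∷ v , p) (λ { (x ∷ v , p) → x , v , p })
                         (∃? λ x → Exhaustible.∃? (vectors n) λ v → P? (x ∷ v)) }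

private
  remove : {X : Set} {x : X} (ys : List X) → x ∈ ys → List X
  remove (_ ∷ ys) (here _)  = ys
  remove (y ∷ ys) (there p) = y ∷ remove ys p

  length-remove : {X : Set} {x : X} (ys : List X) (p : x ∈ ys) → length ys ≡ suc (length (remove ys p))
  length-remove (_ ∷ ys) (here _)  = refl
  length-remove (y ∷ ys) (there p) = cong suc (length-remove ys p)

  ∈-remove : {X : Set} {x z : X} (ys : List X) (p : x ∈ ys) → z ∈ ys → z ≢ x → z ∈ remove ys p
  ∈-remove (_ ∷ ys) (here refl) (here refl) z≢x = ⊥-elim (z≢x refl)
  ∈-remove (_ ∷ ys) (here refl) (there q)   _   = q
  ∈-remove (y ∷ ys) (there p)   (here refl) _   = here refl
  ∈-remove (y ∷ ys) (there p)   (there q)   z≢x = there (∈-remove ys p q z≢x)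

allPairs-map-on : {X : Set} {P : Pred X 0ℓ} {R S : X → X → Set} → (∀ {x y} → P x → P y → R x y → S x y) →
                  ∀ {xs} → All P xs → AllPairs R xs → AllPairs S xs
allPairs-map-on R⇒S {[]}     []         []         = []
allPairs-map-on R⇒S {x ∷ xs} (px ∷ pxs) (rx ∷ rxs) =
  All.zipWith (λ (py , r) → R⇒S px py r) (pxs , rx) ∷ allPairs-map-on R⇒S pxs rxs

set3-list : ∀ {y₁ y₂ y₃ v} → v ∈ (y₁ ∷ y₂ ∷ y₃ ∷ []) ⇔ set3 y₁ y₂ y₃ v
set3-list = mk⇔
  (λ { (here refl) → inj₁ refl ; (there (here refl)) → inj₂ (inj₁ refl) ; (there (there (here refl))) → inj₂ (inj₂ refl) })
  (λ { (inj₁ refl) → here refl ; (inj₂ (inj₁ refl)) → there (here refl) ; (inj₂ (inj₂ refl)) → there (there (here refl)) })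

HasSize-3 : ∀ {P} → HasSize P 3 →
            Σ[ y₁ ∈ V8 ] Σ[ y₂ ∈ V8 ] Σ[ y₃ ∈ V8 ] (y₁ ≢ y₂ × y₁ ≢ y₃ × y₂ ≢ y₃ × P ≐ set3 y₁ y₂ y₃)
HasSize-3 (y₁ ∷ y₂ ∷ y₃ ∷ [] , (y₁≢y₂ ∷ y₁≢y₃ ∷ []) ∷ (y₂≢y₃ ∷ []) ∷ [] ∷ [] , refl , ∈⇔P) =
  y₁ , y₂ , y₃ , y₁≢y₂ , y₁≢y₃ , y₂≢y₃ ,
  (λ Pv → Equivalence.to set3-list (Equivalence.from (∈⇔P _) Pv)) ,
  (λ v∈ → Equivalence.to (∈⇔P _) (Equivalence.from set3-list v∈))

HasSize-set3 : ∀ {y₁ y₂ y₃} → y₁ ≢ y₂ → y₁ ≢ y₃ → y₂ ≢ y₃ → HasSize (set3 y₁ y₂ y₃) 3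
HasSize-set3 y₁≢y₂ y₁≢y₃ y₂≢y₃ =
  _ , (y₁≢y₂ ∷ y₁≢y₃ ∷ []) ∷ (y₂≢y₃ ∷ []) ∷ [] ∷ [] , refl , λ _ → set3-list

unique-⊆-length : {X : Set} {xs ys : List X} → Unique xs → xs ⊆ₗ ys → length xs ≤ length ys
unique-⊆-length {xs = []}     _            _  = z≤n
unique-⊆-length {xs = x ∷ xs} {ys} (x∉xs ∷ u) xs⊆ys =
  subst (suc (length xs) ≤_) (sym (length-remove ys x∈ys))
    (s≤s (unique-⊆-length u λ z∈xs →
       ∈-remove ys x∈ys (xs⊆ys (there z∈xs)) (λ { refl → All.lookup x∉xs z∈xs refl })))
  where x∈ys = xs⊆ys (here refl)

infix  4 _≟₃_ _≟ᵍ_ _≟ₚ_ _≟ᵛ_ _≟ᵗ_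
infixl 21 _+ᵍ_ _-ᵍ_
infixr 22 _·ᵍ_
infix  25 _∙_ _⟨_⟩

_≟₃_ : (a b : F3) → Dec (a ≡ b)
_≟₃_ = Finₚ._≟_

_-₃_ : F3 → F3 → F3
a -₃ b = a +₃ (-₃ b)

-- Facts established by exhaustive search are kept opaque, so that their proofs are never unfolded.
opaque
  +₃-cancelʳ : ∀ a b k → (a +₃ k) -₃ (b +₃ k) ≡ a -₃ b
  +₃-cancelʳ = from-yes (∀? λ a → ∀? λ b → ∀? λ k → (a +₃ k) -₃ (b +₃ k) ≟₃ a -₃ b)

  -₃-+₃ : ∀ v k → (v +₃ k) -₃ k ≡ v
  -₃-+₃ = from-yes (∀? λ v → ∀? λ k → (v +₃ k) -₃ k ≟₃ v)

  +₃-*₃-zero : ∀ v m → v +₃ (m *₃ zero) ≡ v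
  +₃-*₃-zero = from-yes (∀? λ v → ∀? λ m → v +₃ (m *₃ zero) ≟₃ v)

Grid : Set
Grid = F3 × F3 × F3

_≟ᵍ_ : (g h : Grid) → Dec (g ≡ h)
_≟ᵍ_ = Productₚ.≡-dec _≟₃_ (Productₚ.≡-dec _≟₃_ _≟₃_)

0ᵍ : Grid
0ᵍ = zero , zero , zero

_+ᵍ_ _-ᵍ_ : Grid → Grid → Grid
(a , b , c) +ᵍ (a′ , b′ , c′) = a +₃ a′ , b +₃ b′ , c +₃ c′
(a , b , c) -ᵍ (a′ , b′ , c′) = a -₃ a′ , b -₃ b′ , c -₃ c′

-ᵍ_ : Grid → Grid
-ᵍ (a , b , c) = -₃ a , -₃ b , -₃ c

_·ᵍ_ : F3 → Grid → Grid
m ·ᵍ (a , b , c) = m *₃ a , m *₃ b , m *₃ c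

·ᵍ-one : ∀ d → one ·ᵍ d ≡ d
·ᵍ-one (a , b , c) = refl

·ᵍ-two : ∀ d → two ·ᵍ d ≡ -ᵍ d
·ᵍ-two (a , b , c) = refl

opaque
  +ᵍ-difference : ∀ g h → g +ᵍ (h -ᵍ g) ≡ h
  +ᵍ-difference = from-yes (∀? λ g → ∀? λ h → g +ᵍ (h -ᵍ g) ≟ᵍ h)

  +ᵍ-0 : ∀ g → g +ᵍ 0ᵍ ≡ g
  +ᵍ-0 = from-yes (∀? λ g → g +ᵍ 0ᵍ ≟ᵍ g)

Sign : Set
Sign = Bool

-- false and true stand for the units +1 and −1 of 𝔽₃.
⟦_⟧ : Sign → F3
⟦ false ⟧ = one
⟦ true  ⟧ = two

opaque
  difference-unit : ∀ m m′ → m ≢ m′ → Σ Sign λ σ → m -₃ m′ ≡ ⟦ σ ⟧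
  difference-unit = from-yes (∀? λ m → ∀? λ m′ → ¬? (m ≟₃ m′) →-dec ∃? λ σ → m -₃ m′ ≟₃ ⟦ σ ⟧)

opaque
  line-covers : ∀ m₁ σ σ′ → σ ≢ σ′ → ∀ m → m ≡ m₁ ⊎ m ≡ m₁ +₃ ⟦ σ ⟧ ⊎ m ≡ m₁ +₃ ⟦ σ′ ⟧
  line-covers = from-yes (∀? λ m₁ → ∀? λ σ → ∀? λ σ′ → ¬? (σ Boolₚ.≟ σ′) →-dec ∀? λ m →
    m ≟₃ m₁ ⊎-dec m ≟₃ m₁ +₃ ⟦ σ ⟧ ⊎-dec m ≟₃ m₁ +₃ ⟦ σ′ ⟧)

Form : Set
Form = Sign × Sign × Sign

_∙_ : Form → Grid → F3
(s , t , u) ∙ (a , b , c) = (⟦ s ⟧ *₃ a) +₃ ((⟦ t ⟧ *₃ b) +₃ (⟦ u ⟧ *₃ c))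

opaque
  ∙-- : ∀ r g h → r ∙ (g -ᵍ h) ≡ (r ∙ g) -₃ (r ∙ h)
  ∙-- = from-yes (∀? λ (r : Form) → ∀? λ g → ∀? λ h → r ∙ (g -ᵍ h) ≟₃ ((r ∙ g) -₃ (r ∙ h)))

  ∙-negate : ∀ r d → r ∙ (-ᵍ d) ≡ -₃ (r ∙ d)
  ∙-negate = from-yes (∀? λ r → ∀? λ d → r ∙ (-ᵍ d) ≟₃ (-₃ (r ∙ d)))

-- r and r′ are proportional (r′ = ± r) iff their signs differ in all places or in none.
Proportional : Form → Form → Set
Proportional (s , t , u) (s′ , t′ , u′) = T (not ((s xor s′) xor (t xor t′)) ∧ not ((s xor s′) xor (u xor u′)))

proportional? : ∀ r r′ → Dec (Proportional r r′)
proportional? (s , t , u) (s′ , t′ , u′) = T? _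

opaque
  proportional⇒scaled : ∀ r r′ → Proportional r r′ → Σ Sign λ σ → ∀ g → r′ ∙ g ≡ ⟦ σ ⟧ *₃ (r ∙ g)
  proportional⇒scaled = from-yes (∀? λ r → ∀? λ r′ → proportional? r r′ →-dec
    ∃? λ σ → ∀? λ g → r′ ∙ g ≟₃ ⟦ σ ⟧ *₃ (r ∙ g))

Affine : Set
Affine = Form × F3

_⟨_⟩ : Affine → Grid → F3
(r , k) ⟨ g ⟩ = (r ∙ g) +₃ k

opaque
  affine-along : ∀ f b m d → f ⟨ b +ᵍ m ·ᵍ d ⟩ ≡ f ⟨ b ⟩ +₃ (m *₃ (proj₁ f ∙ d))
  affine-along = from-yes (∀? λ f → ∀? λ b → ∀? λ m → ∀? λ d →
    f ⟨ b +ᵍ m ·ᵍ d ⟩ ≟₃ f ⟨ b ⟩ +₃ (m *₃ (proj₁ f ∙ d)))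

affine-difference : ∀ f g h → f ⟨ g ⟩ -₃ f ⟨ h ⟩ ≡ proj₁ f ∙ (g -ᵍ h)
affine-difference (r , k) g h = trans (+₃-cancelʳ (r ∙ g) (r ∙ h) k) (sym (∙-- r g h))

opaque
  affine-vertical-onto : ∀ f C v →
    v ≡ f ⟨ zero , zero , C ⟩ ⊎ v ≡ f ⟨ zero , zero , C +₃ one ⟩ ⊎ v ≡ f ⟨ zero , zero , C +₃ two ⟩
  affine-vertical-onto = from-yes (∀? λ f → ∀? λ C → ∀? λ v →
    v ≟₃ f ⟨ zero , zero , C ⟩ ⊎-dec v ≟₃ f ⟨ zero , zero , C +₃ one ⟩
                               ⊎-dec v ≟₃ f ⟨ zero , zero , C +₃ two ⟩)

infixl 6 _⊕ₚ_

_⊕ₚ_ : Pair → Pair → Pair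
(a , b) ⊕ₚ (c , d) = a xor c , b xor d

0ₚ : Pair
0ₚ = false , false

_≟ₚ_ : (x y : Pair) → Dec (x ≡ y)
_≟ₚ_ = Productₚ.≡-dec Boolₚ._≟_ Boolₚ._≟_

⨁ : List Pair → Pair
⨁ = foldr _⊕ₚ_ 0ₚ

NonZero : Pair → Set
NonZero (a , b) = T (a ∨ b)

nonZero? : ∀ x → Dec (NonZero x)
nonZero? (a , b) = T? (a ∨ b)

-- orbit n = ζₐⁿ (1,1), and label is its inverse on nonzero pairs.
orbit : F3 → Pair
orbit zero             = true , true
orbit (suc zero)       = true , false
orbit (suc (suc zero)) = false , true

label : Pair → F3
label (true , false) = one
label (false , true) = two
label _              = zero

opaque
  orbit-label : ∀ x → NonZero x → orbit (label x) ≡ x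
  orbit-label = from-yes (∀? λ x → nonZero? x →-dec orbit (label x) ≟ₚ x)

  orbit-nonzero : ∀ v → NonZero (orbit v)
  orbit-nonzero = from-yes (∀? λ v → nonZero? (orbit v))

orbitSum : F3 → F3 → Pair
orbitSum v σ = orbit (v +₃ (zero *₃ σ)) ⊕ₚ orbit (v +₃ (one *₃ σ)) ⊕ₚ orbit (v +₃ (two *₃ σ))

opaque
  orbitSum-flat : ∀ v → orbitSum v zero ≡ orbit v
  orbitSum-flat = from-yes (∀? λ v → orbitSum v zero ≟ₚ orbit v)

  orbitSum-steep : ∀ v σ → σ ≢ zero → orbitSum v σ ≡ 0ₚ
  orbitSum-steep = from-yes (∀? λ v → ∀? λ σ → ¬? (σ ≟₃ zero) →-dec orbitSum v σ ≟ₚ 0ₚ)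

-- The bijection of nonzero pairs induced by the affine relabelling v ↦ σ (v − k) + k′, extended by 0 ↦ 0.
relabel : Sign → F3 → F3 → Pair → Pair
relabel σ k k′ (a , b) = if a ∨ b then orbit ((⟦ σ ⟧ *₃ (label (a , b) -₃ k)) +₃ k′) else 0ₚ

opaque
  relabel-additive : ∀ σ k k′ x y → relabel σ k k′ (x ⊕ₚ y) ≡ relabel σ k k′ x ⊕ₚ relabel σ k k′ y
  relabel-additive = from-yes (∀? λ σ → ∀? λ k → ∀? λ k′ → ∀? λ x → ∀? λ y →
    relabel σ k k′ (x ⊕ₚ y) ≟ₚ relabel σ k k′ x ⊕ₚ relabel σ k k′ y)

relabel-nonzero : ∀ σ k k′ x → NonZero x → relabel σ k k′ x ≡ orbit ((⟦ σ ⟧ *₃ (label x -₃ k)) +₃ k′)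
relabel-nonzero σ k k′ (true  , _)    _ = refl
relabel-nonzero σ k k′ (false , true) _ = refl

_≟ᵛ_ : (x y : V2) → Dec (x ≡ y)
_≟ᵛ_ = Vecₚ.≡-dec Boolₚ._≟_

_≟ᵗ_ : (S T : Tensor) → Dec (S ≡ T)
_≟ᵗ_ = Vecₚ.≡-dec (Vecₚ.≡-dec (Vecₚ.≡-dec Boolₚ._≟_))

Basis : Set
Basis = Fin 2 × Fin 2 × Fin 2

_≟ᵇ_ : (β β′ : Basis) → Dec (β ≡ β′)
_≟ᵇ_ = Productₚ.≡-dec Finₚ._≟_ (Productₚ.≡-dec Finₚ._≟_ Finₚ._≟_)

_!_ : Tensor → Basis → Bool
T ! (i , j , k) = lookup (lookup (lookup T i) j) k

nz : F3 → V2
nz zero             = true ∷ false ∷ []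
nz (suc zero)       = false ∷ true ∷ []
nz (suc (suc zero)) = true ∷ true ∷ []

nz-onto : ∀ x → x ≢ 0₂ → Σ F3 λ a → x ≡ nz a
nz-onto (false ∷ false ∷ []) x≢0 = ⊥-elim (x≢0 refl)
nz-onto (true  ∷ false ∷ []) _   = zero , refl
nz-onto (false ∷ true  ∷ []) _   = one , refl
nz-onto (true  ∷ true  ∷ []) _   = two , refl

opaque
  nz-injective : ∀ {a b} → nz a ≡ nz b → a ≡ b
  nz-injective {a} {b} = from-yes (∀? λ a → ∀? λ b → (nz a ≟ᵛ nz b) →-dec (a ≟₃ b)) a b

nz≢0 : ∀ a → nz a ≢ 0₂
nz≢0 zero             ()
nz≢0 (suc zero)       ()
nz≢0 (suc (suc zero)) ()

pure : Grid → Tensor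
pure (a , b , c) = nz a ⊗ nz b ⊗ nz c

opaque
  pure-injective : ∀ g h → pure g ≡ pure h → g ≡ h
  pure-injective = from-yes (∀? λ g → ∀? λ h → (pure g ≟ᵗ pure h) →-dec (g ≟ᵍ h))

opaque
  pure≢0 : ∀ g → pure g ≢ 0t
  pure≢0 = from-yes (∀? λ g → ¬? (pure g ≟ᵗ 0t))

opaque
  pure-tensor : ∀ x y z → x ⊗ y ⊗ z ≢ 0t → Σ Grid λ g → x ⊗ y ⊗ z ≡ pure g
  pure-tensor = from-yes (∀? λ x → ∀? λ y → ∀? λ z →
    ¬? (x ⊗ y ⊗ z ≟ᵗ 0t) →-dec ∃? λ g → x ⊗ y ⊗ z ≟ᵗ pure g)

-- nz ∘ ι is the standard basis of V(2,2), so unit runs over the standard basis of the tensor product.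
ι : Fin 2 → F3
ι zero       = zero
ι (suc zero) = one

unit : Basis → Tensor
unit (i , j , k) = pure (ι i , ι j , ι k)

⨁ᵗ : List Tensor → Tensor
⨁ᵗ = foldr _⊞_ 0t

basis : List Basis
basis = cartesianProduct (allFin 2) (cartesianProduct (allFin 2) (allFin 2))

support : Tensor → List Basis
support T = filter (λ β → T? (T ! β)) basis

bits : F3 → List (Fin 2)
bits zero             = zero ∷ []
bits (suc zero)       = suc zero ∷ []
bits (suc (suc zero)) = zero ∷ suc zero ∷ []

pureSupport : Grid → List Basis
pureSupport (a , b , c) = concatMap (λ i → concatMap (λ j → map (λ k → i , j , k) (bits c)) (bits b)) (bits a)

opaque
  support-pure : ∀ g → support (pure g) ≡ pureSupport g
  support-pure = from-yes (∀? λ g → Data.List.Properties.≡-dec _≟ᵇ_ (support (pure g)) (pureSupport g))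

opaque
  tensor-expansion : ∀ T → T ≡ ⨁ᵗ (map unit (support T))
  tensor-expansion = from-yes (∀? λ T → T ≟ᵗ ⨁ᵗ (map unit (support T)))

Additive : (Tensor → Pair) → Set
Additive ψ = ∀ S T → ψ (S ⊞ T) ≡ ψ S ⊕ₚ ψ T

additive-0 : ∀ {ψ} → Additive ψ → ψ 0t ≡ 0ₚ
additive-0 {ψ} ψ-additive with ψ 0t | ψ-additive 0t 0t
... | false , false | _ = refl
... | true  , _     | ()
... | false , true  | ()

additive-⨁ : ∀ {ψ} → Additive ψ → ∀ Ts → ψ (⨁ᵗ Ts) ≡ ⨁ (map ψ Ts)
additive-⨁ {ψ} ψ-additive []       = additive-0 {ψ} ψ-additive
additive-⨁ {ψ} ψ-additive (T ∷ Ts) =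
  trans (ψ-additive T (⨁ᵗ Ts)) (cong (ψ T ⊕ₚ_) (additive-⨁ {ψ} ψ-additive Ts))

additive-on-support : ∀ {ψ} → Additive ψ → ∀ T → ψ T ≡ ⨁ (map (ψ ∘ unit) (support T))
additive-on-support {ψ} ψ-additive T = begin
  ψ T                                    ≡⟨ cong ψ (tensor-expansion T) ⟩
  ψ (⨁ᵗ (map unit (support T)))         ≡⟨ additive-⨁ {ψ} ψ-additive (map unit (support T)) ⟩
  ⨁ (map ψ (map unit (support T)))      ≡⟨ cong ⨁ (sym (Data.List.Properties.map-∘ (support T))) ⟩
  ⨁ (map (ψ ∘ unit) (support T))        ∎
  where open ≡-Reasoning

additive-unique : ∀ {ψ χ} → Additive ψ → Additive χ → (∀ β → ψ (unit β) ≡ χ (unit β)) → ∀ T → ψ T ≡ χ T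
additive-unique {ψ} {χ} ψ-additive χ-additive on-basis T = begin
  ψ T                                   ≡⟨ additive-on-support {ψ} ψ-additive T ⟩
  ⨁ (map (ψ ∘ unit) (support T))       ≡⟨ cong ⨁ (Data.List.Properties.map-cong on-basis (support T)) ⟩
  ⨁ (map (χ ∘ unit) (support T))       ≡⟨ sym (additive-on-support {χ} χ-additive T) ⟩
  χ T                                   ∎
  where open ≡-Reasoning

Cube : Set → Set
Cube X = Vec (Vec (Vec X 2) 2) 2

_!ᶜ_ : {X : Set} → Cube X → Basis → X
l !ᶜ (i , j , k) = lookup (lookup (lookup l i) j) k

signOf : F3 → Sign
signOf (suc (suc zero)) = true
signOf _                = false

-- valueAt l is the additive map sending the basis tensor β to orbit (l β), restricted to pure
-- tensors; affineFit l is the affine map through its labels at 0 and at the three unit vectors.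
valueAt : Cube F3 → Grid → Pair
valueAt l g = ⨁ (map (orbit ∘ (l !ᶜ_)) (pureSupport g))

affineFit : Cube F3 → Affine
affineFit l = (slope (one , zero , zero) , slope (zero , one , zero) , slope (zero , zero , one)) , k
  where
  k = label (valueAt l 0ᵍ)
  slope : Grid → Sign
  slope g = signOf (label (valueAt l g) -₃ k)

opaque
  valueAt-affine : ∀ l → (∀ g → NonZero (valueAt l g)) → ∀ g → label (valueAt l g) ≡ affineFit l ⟨ g ⟩
  valueAt-affine = from-yes (∀? λ l → ∀? (λ g → nonZero? (valueAt l g)) →-dec
                                     ∀? λ g → label (valueAt l g) ≟₃ affineFit l ⟨ g ⟩)

tabulateᶜ : {X : Set} → (Basis → X) → Cube X
tabulateᶜ f = tabulate λ i → tabulate λ j → tabulate λ k → f (i , j , k)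

!ᶜ-tabulateᶜ : {X : Set} (f : Basis → X) → ∀ β → tabulateᶜ f !ᶜ β ≡ f β
!ᶜ-tabulateᶜ f (i , j , k)
  rewrite Vecₚ.lookup∘tabulate (λ i → tabulate λ j → tabulate λ k → f (i , j , k)) i
        | Vecₚ.lookup∘tabulate (λ j → tabulate λ k → f (i , j , k)) j
        | Vecₚ.lookup∘tabulate (λ k → f (i , j , k)) k = refl

opaque
  affine-label : ∀ ψ → Additive ψ → (∀ g → NonZero (ψ (pure g))) →
                 Σ Affine λ f → ∀ g → label (ψ (pure g)) ≡ f ⟨ g ⟩
  affine-label ψ ψ-additive ψ≢0 =
    affineFit labels , λ g → trans (cong label (ψ-pure g))
                                   (valueAt-affine labels (λ h → subst NonZero (ψ-pure h) (ψ≢0 h)) g)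
    where
    labels : Cube F3
    labels = tabulateᶜ (label ∘ ψ ∘ unit)

    on-basis : ∀ β → ψ (unit β) ≡ orbit (labels !ᶜ β)
    on-basis β@(i , j , k) = sym (trans (cong orbit (!ᶜ-tabulateᶜ (label ∘ ψ ∘ unit) β))
                                        (orbit-label _ (ψ≢0 (ι i , ι j , ι k))))

    ψ-pure : ∀ g → ψ (pure g) ≡ valueAt labels g
    ψ-pure g = begin
      ψ (pure g)                                  ≡⟨ additive-on-support {ψ} ψ-additive (pure g) ⟩
      ⨁ (map (ψ ∘ unit) (support (pure g)))      ≡⟨ cong (⨁ ∘ map (ψ ∘ unit)) (support-pure g) ⟩
      ⨁ (map (ψ ∘ unit) (pureSupport g))         ≡⟨ cong ⨁ (Data.List.Properties.map-cong on-basis (pureSupport g)) ⟩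
      valueAt labels g                            ∎
      where open ≡-Reasoning

-- Points of ω₄, their coordinates and Hamming distance

-- The components in V_b and V_d are read in reverse order, so that ζ_b, ζ_c, ζ_d all act as ζ_a.
component : Fin 4 → V8 → Pair
component zero                   (x1 ∷ _  ∷ _  ∷ _  ∷ _  ∷ _  ∷ _  ∷ x8 ∷ []) = x1 , x8
component (suc zero)             (_  ∷ x2 ∷ _  ∷ _  ∷ _  ∷ _  ∷ x7 ∷ _  ∷ []) = x7 , x2
component (suc (suc zero))       (_  ∷ _  ∷ x3 ∷ _  ∷ _  ∷ x6 ∷ _  ∷ _  ∷ []) = x3 , x6
component (suc (suc (suc zero))) (_  ∷ _  ∷ _  ∷ x4 ∷ x5 ∷ _  ∷ _  ∷ _  ∷ []) = x5 , x4

component-⊕ : ∀ i x y → component i (x ⊕ y) ≡ component i x ⊕ₚ component i y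
component-⊕ zero                   (_ ∷ _ ∷ _ ∷ _ ∷ _ ∷ _ ∷ _ ∷ _ ∷ []) (_ ∷ _ ∷ _ ∷ _ ∷ _ ∷ _ ∷ _ ∷ _ ∷ []) = refl
component-⊕ (suc zero)             (_ ∷ _ ∷ _ ∷ _ ∷ _ ∷ _ ∷ _ ∷ _ ∷ []) (_ ∷ _ ∷ _ ∷ _ ∷ _ ∷ _ ∷ _ ∷ _ ∷ []) = refl
component-⊕ (suc (suc zero))       (_ ∷ _ ∷ _ ∷ _ ∷ _ ∷ _ ∷ _ ∷ _ ∷ []) (_ ∷ _ ∷ _ ∷ _ ∷ _ ∷ _ ∷ _ ∷ _ ∷ []) = refl
component-⊕ (suc (suc (suc zero))) (_ ∷ _ ∷ _ ∷ _ ∷ _ ∷ _ ∷ _ ∷ _ ∷ []) (_ ∷ _ ∷ _ ∷ _ ∷ _ ∷ _ ∷ _ ∷ _ ∷ []) = refl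

component-ext : ∀ x y → (∀ i → component i x ≡ component i y) → x ≡ y
component-ext (_ ∷ _ ∷ _ ∷ _ ∷ _ ∷ _ ∷ _ ∷ _ ∷ []) (_ ∷ _ ∷ _ ∷ _ ∷ _ ∷ _ ∷ _ ∷ _ ∷ []) same
  with same zero | same (suc zero) | same (suc (suc zero)) | same (suc (suc (suc zero)))
... | refl | refl | refl | refl = refl

ω4-components : ∀ x → ω4 x → ∀ i → NonZero (component i x)
ω4-components (_ ∷ x2 ∷ _ ∷ x4 ∷ x5 ∷ _ ∷ x7 ∷ _ ∷ []) (a , b , c , d) = λ where
  zero                   → Equivalence.from Boolₚ.T-≡ a
  (suc zero)             → Equivalence.from Boolₚ.T-≡ (trans (Boolₚ.∨-comm x7 x2) b)
  (suc (suc zero))       → Equivalence.from Boolₚ.T-≡ c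
  (suc (suc (suc zero))) → Equivalence.from Boolₚ.T-≡ (trans (Boolₚ.∨-comm x5 x4) d)

coordinates : V8 → F34
coordinates x = tabulate λ i → label (component i x)

_≟⁴_ : (μ ν : F34) → Dec (μ ≡ ν)
_≟⁴_ = Vecₚ.≡-dec _≟₃_

_≟⁸_ : (x y : V8) → Dec (x ≡ y)
_≟⁸_ = Vecₚ.≡-dec Boolₚ._≟_

opaque
  coordinates-p : ∀ λ′ → coordinates (p λ′) ≡ λ′
  coordinates-p = from-yes (∀? λ λ′ → coordinates (p λ′) ≟⁴ λ′)

opaque
  p-coordinates : ∀ x → (∀ i → NonZero (component i x)) → p (coordinates x) ≡ x
  p-coordinates = from-yes (∀? λ x → ∀? (λ i → nonZero? (component i x)) →-dec p (coordinates x) ≟⁸ x)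

p-injective : ∀ {ρ σ} → p ρ ≡ p σ → ρ ≡ σ
p-injective {ρ} {σ} pρ≡pσ = trans (sym (coordinates-p ρ)) (trans (cong coordinates pρ≡pσ) (coordinates-p σ))

single : Fin 4 → Pair → V8
single zero                   (a , b) = a ∷ false ∷ false ∷ false ∷ false ∷ false ∷ false ∷ b ∷ []
single (suc zero)             (a , b) = false ∷ b ∷ false ∷ false ∷ false ∷ false ∷ a ∷ false ∷ []
single (suc (suc zero))       (a , b) = false ∷ false ∷ a ∷ false ∷ false ∷ b ∷ false ∷ false ∷ []
single (suc (suc (suc zero))) (a , b) = false ∷ false ∷ false ∷ b ∷ a ∷ false ∷ false ∷ false ∷ []

opaque
  component-single-same : ∀ i x → component i (single i x) ≡ x
  component-single-same = from-yes (∀? λ i → ∀? λ x → component i (single i x) ≟ₚ x)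

  component-single-other : ∀ i j x → i ≢ j → component i (single j x) ≡ 0ₚ
  component-single-other = from-yes (∀? λ i → ∀? λ j → ∀? λ x →
    ¬? (i Finₚ.≟ j) →-dec component i (single j x) ≟ₚ 0ₚ)

PV : Fin 4 → Subset8
PV zero                   = PVa
PV (suc zero)             = PVb
PV (suc (suc zero))       = PVc
PV (suc (suc (suc zero))) = PVd

single∈PV : ∀ i x → NonZero x → PV i (single i x)
single∈PV zero                   _       x≢0 = Equivalence.to Boolₚ.T-≡ x≢0 , refl , refl , refl , refl , refl , refl
single∈PV (suc zero)             (a , b) x≢0 =
  trans (Boolₚ.∨-comm b a) (Equivalence.to Boolₚ.T-≡ x≢0) , refl , refl , refl , refl , refl , refl
single∈PV (suc (suc zero))       _       x≢0 = Equivalence.to Boolₚ.T-≡ x≢0 , refl , refl , refl , refl , refl , refl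
single∈PV (suc (suc (suc zero))) (a , b) x≢0 =
  trans (Boolₚ.∨-comm b a) (Equivalence.to Boolₚ.T-≡ x≢0) , refl , refl , refl , refl , refl , refl

PV⇒single : ∀ i y → PV i y → y ≡ single i (component i y) × NonZero (component i y)
PV⇒single zero                   (_ ∷ _ ∷ _ ∷ _ ∷ _ ∷ _ ∷ _ ∷ _ ∷ []) (x≢0 , refl , refl , refl , refl , refl , refl) =
  refl , Equivalence.from Boolₚ.T-≡ x≢0
PV⇒single (suc zero)             (_ ∷ x2 ∷ _ ∷ _ ∷ _ ∷ _ ∷ x7 ∷ _ ∷ []) (x≢0 , refl , refl , refl , refl , refl , refl) =
  refl , Equivalence.from Boolₚ.T-≡ (trans (Boolₚ.∨-comm x7 x2) x≢0)
PV⇒single (suc (suc zero))       (_ ∷ _ ∷ _ ∷ _ ∷ _ ∷ _ ∷ _ ∷ _ ∷ []) (x≢0 , refl , refl , refl , refl , refl , refl) =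
  refl , Equivalence.from Boolₚ.T-≡ x≢0
PV⇒single (suc (suc (suc zero))) (_ ∷ _ ∷ _ ∷ x4 ∷ x5 ∷ _ ∷ _ ∷ _ ∷ []) (x≢0 , refl , refl , refl , refl , refl , refl) =
  refl , Equivalence.from Boolₚ.T-≡ (trans (Boolₚ.∨-comm x5 x4) x≢0)

PV-cases : ∀ i {S : Subset8} → S ≐ PV i → S ≐ PVa ⊎ S ≐ PVb ⊎ S ≐ PVc ⊎ S ≐ PVd
PV-cases zero                   S≐ = inj₁ S≐
PV-cases (suc zero)             S≐ = inj₂ (inj₁ S≐)
PV-cases (suc (suc zero))       S≐ = inj₂ (inj₂ (inj₁ S≐))
PV-cases (suc (suc (suc zero))) S≐ = inj₂ (inj₂ (inj₂ S≐))

-- fromΞ is an involution, so the Ξ-coordinates of μ are fromΞ μ; ξ computes them entrywise.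
ξ : F34 → F34
ξ (a ∷ b ∷ c ∷ d ∷ []) = ((a +₃ (two *₃ b)) +₃ ((two *₃ c) +₃ d)) ∷ (((two *₃ a) +₃ b) +₃ ((two *₃ c) +₃ d))
                      ∷ (((two *₃ a) +₃ (two *₃ b)) +₃ (c +₃ d)) ∷ ((a +₃ b) +₃ (c +₃ d)) ∷ []

opaque
  ξ≗fromΞ : ∀ μ → ξ μ ≡ fromΞ μ
  ξ≗fromΞ = from-yes (∀? λ μ → ξ μ ≟⁴ fromΞ μ)

opaque
  fromΞ-involutive : ∀ μ → fromΞ (fromΞ μ) ≡ μ
  fromΞ-involutive = from-yes (∀? λ μ → fromΞ (fromΞ μ) ≟⁴ μ)

weight : F34 → ℕ
weight μ = nzCount (ξ μ)

WtΞ⇔weight : ∀ μ k → WtΞ μ k ⇔ weight μ ≡ k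
WtΞ⇔weight μ k = mk⇔ to from
  where
  to : WtΞ μ k → weight μ ≡ k
  to (c , refl , count≡k) = trans (cong nzCount (trans (ξ≗fromΞ (fromΞ c)) (fromΞ-involutive c))) count≡k
  from : weight μ ≡ k → WtΞ μ k
  from weight≡k = ξ μ , trans (cong fromΞ (ξ≗fromΞ μ)) (fromΞ-involutive μ) , weight≡k

HD-p⇔weight : ∀ ρ σ k → HD (p ρ) (p σ) k ⇔ weight (ρ -v σ) ≡ k
HD-p⇔weight ρ σ k = mk⇔
  (λ (ρ′ , σ′ , pρ≡pρ′ , pσ≡pσ′ , wt) →
     Equivalence.to (WtΞ⇔weight _ k)
       (subst₂ (λ ρ″ σ″ → WtΞ (ρ″ -v σ″) k) (sym (p-injective pρ≡pρ′)) (sym (p-injective pσ≡pσ′)) wt))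
  (λ weight≡k → ρ , σ , refl , refl , Equivalence.from (WtΞ⇔weight _ k) weight≡k)

opaque
  weight-negate : ∀ μ → weight (two ·v μ) ≡ weight μ
  weight-negate = from-yes (∀? λ μ → weight (two ·v μ) Data.Nat.≟ weight μ)

SignMatrix : Set
SignMatrix = Vec Form 4

_⊛_ : SignMatrix → Grid → F34
E ⊛ g = Data.Vec.map (_∙ g) E

⊛-negate : ∀ E d → E ⊛ (-ᵍ d) ≡ two ·v (E ⊛ d)
⊛-negate E d = begin
  E ⊛ (-ᵍ d)                                  ≡⟨ Vecₚ.map-cong (λ r → ∙-negate r d) E ⟩
  Data.Vec.map (λ r → -₃ (r ∙ d)) E           ≡⟨ Vecₚ.map-∘ (two *₃_) (_∙ d) E ⟩
  two ·v (E ⊛ d)                              ∎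
  where open ≡-Reasoning

weight-⊛-negate : ∀ E d → weight (E ⊛ (-ᵍ d)) ≡ weight (E ⊛ d)
weight-⊛-negate E d = trans (cong weight (⊛-negate E d)) (weight-negate (E ⊛ d))

Independent : SignMatrix → Set
Independent E = AllPairs (λ r r′ → ¬ Proportional r r′) (Data.Vec.toList E)

independent? : ∀ E → Dec (Independent E)
independent? E = AllPairs.allPairs? (λ r r′ → ¬? (proportional? r r′)) (Data.Vec.toList E)

-- The plane of directions c = s a + t b, and its four directions up to sign.
InPlane : Sign → Sign → Grid → Set
InPlane s t (a , b , c) = c ≡ (⟦ s ⟧ *₃ a) +₃ (⟦ t ⟧ *₃ b)

inPlane? : ∀ s t d → Dec (InPlane s t d)
inPlane? s t (a , b , c) = c ≟₃ (⟦ s ⟧ *₃ a) +₃ (⟦ t ⟧ *₃ b)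

direction : Sign → Sign → Fin 4 → Grid
direction s t zero                   = one , zero , ⟦ s ⟧
direction s t (suc zero)             = zero , one , ⟦ t ⟧
direction s t (suc (suc zero))       = one , one , ⟦ s ⟧ +₃ ⟦ t ⟧
direction s t (suc (suc (suc zero))) = one , two , ⟦ s ⟧ +₃ (two *₃ ⟦ t ⟧)

opaque
  in-plane-direction : ∀ s t d → InPlane s t d → d ≢ 0ᵍ →
                       Σ (Fin 4) λ w → d ≡ direction s t w ⊎ d ≡ -ᵍ direction s t w
  in-plane-direction = from-yes (∀? λ s → ∀? λ t → ∀? λ d → inPlane? s t d →-dec ¬? (d ≟ᵍ 0ᵍ) →-dec
    ∃? λ w → d ≟ᵍ direction s t w ⊎-dec d ≟ᵍ -ᵍ direction s t w)

record PlaneProfile (E : SignMatrix) (s t : Sign) : Set where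
  field
    w               : Fin 4
    weight-w        : weight (E ⊛ direction s t w) ≡ 3
    only-w          : ∀ w′ → weight (E ⊛ direction s t w′) ≡ 3 → w′ ≡ w
    x               : Fin 4
    x-vanishes      : ∀ w′ → lookup E x ∙ direction s t w′ ≡ zero
    only-x-vanishes : ∀ i → lookup E i ∙ direction s t w ≡ zero → i ≡ x

planeProfile? : ∀ E s t → Dec (PlaneProfile E s t)
planeProfile? E s t =
  map′ (λ (w , ww , ow , x , xv , ox) → record { w = w ; weight-w = ww ; only-w = ow
                                               ; x = x ; x-vanishes = xv ; only-x-vanishes = ox })
       (λ pp → let open PlaneProfile pp in w , weight-w , only-w , x , x-vanishes , only-x-vanishes)
       (∃? λ w → (weight (E ⊛ direction s t w) Data.Nat.≟ 3)
         ×-dec (∀? λ w′ → (weight (E ⊛ direction s t w′) Data.Nat.≟ 3) →-dec (w′ Finₚ.≟ w))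
         ×-dec ∃? λ x → (∀? λ w′ → lookup E x ∙ direction s t w′ ≟₃ zero)
                 ×-dec (∀? λ i → (lookup E i ∙ direction s t w ≟₃ zero) →-dec (i Finₚ.≟ x)))

opaque
  plane-profile : ∀ E → Independent E → ∀ s t → PlaneProfile E s t
  plane-profile = from-yes (∀? λ E → independent? E →-dec ∀? λ s → ∀? λ t → planeProfile? E s t)

weight-3-direction : ∀ {E s t} (profile : PlaneProfile E s t) → let open PlaneProfile profile in
                     ∀ d → InPlane s t d → d ≢ 0ᵍ → weight (E ⊛ d) ≡ 3 →
                     d ≡ direction s t w ⊎ d ≡ -ᵍ direction s t w
weight-3-direction {E} {s} {t} profile d d∈plane d≢0 weight≡3 with in-plane-direction s t d d∈plane d≢0
... | w′ , inj₁ refl = inj₁ (cong (direction s t) (only-w w′ weight≡3))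
  where open PlaneProfile profile
... | w′ , inj₂ refl =
  inj₂ (cong (λ w″ → -ᵍ direction s t w″) (only-w w′ (trans (sym (weight-⊛-negate E _)) weight≡3)))
  where open PlaneProfile profile

-- Affine planes of the grid, their lines and their points

Plane : Set
Plane = Sign × Sign × F3

height : Plane → F3 → F3 → F3
height (s , t , C) a b = (⟦ s ⟧ *₃ a) +₃ ((⟦ t ⟧ *₃ b) +₃ C)

OnPlane : Plane → Grid → Set
OnPlane π (a , b , c) = c ≡ height π a b

onPlane? : ∀ π g → Dec (OnPlane π g)
onPlane? π (a , b , c) = c ≟₃ height π a b

_≟π_ : (π π′ : Plane) → Dec (π ≡ π′)
_≟π_ = Productₚ.≡-dec Boolₚ._≟_ (Productₚ.≡-dec Boolₚ._≟_ _≟₃_)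

shift : Plane → F3 → Plane
shift (s , t , C) m = s , t , C +₃ m

-- The plane π is swept by the lines in direction w through the points lineBase π w j.
complement : Fin 4 → Fin 4
complement zero = suc zero
complement _    = zero

lineBase : Plane → Fin 4 → F3 → Grid
lineBase (s , t , C) w j = (zero , zero , C) +ᵍ j ·ᵍ direction s t (complement w)

lineDirection : Plane → Fin 4 → Grid
lineDirection (s , t , _) = direction s t

linePoint : Plane → Fin 4 → F3 → F3 → Grid
linePoint π w j m = lineBase π w j +ᵍ m ·ᵍ lineDirection π w

opaque
  linePoint-on-plane : ∀ π w j m → OnPlane π (linePoint π w j m)
  linePoint-on-plane = from-yes (∀? λ π → ∀? λ w → ∀? λ j → ∀? λ m → onPlane? π (linePoint π w j m))

opaque
  linePoint-injective : ∀ π w j m j′ m′ → linePoint π w j m ≡ linePoint π w j′ m′ → j ≡ j′ × m ≡ m′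
  linePoint-injective = from-yes (∀? λ π → ∀? λ w → ∀? λ j → ∀? λ m → ∀? λ j′ → ∀? λ m′ →
    (linePoint π w j m ≟ᵍ linePoint π w j′ m′) →-dec (j ≟₃ j′ ×-dec m ≟₃ m′))

opaque
  linePoint-onto : ∀ π w g → OnPlane π g → Σ[ j ∈ F3 ] Σ[ m ∈ F3 ] g ≡ linePoint π w j m
  linePoint-onto = from-yes (∀? λ π → ∀? λ w → ∀? λ g → onPlane? π g →-dec
    ∃? λ j → ∃? λ m → g ≟ᵍ linePoint π w j m)

opaque
  linePoint-step : ∀ π w j m σ → linePoint π w j m +ᵍ ⟦ σ ⟧ ·ᵍ lineDirection π w ≡ linePoint π w j (m +₃ ⟦ σ ⟧)
  linePoint-step = from-yes (∀? λ π → ∀? λ w → ∀? λ j → ∀? λ m → ∀? λ σ →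
    linePoint π w j m +ᵍ ⟦ σ ⟧ ·ᵍ lineDirection π w ≟ᵍ linePoint π w j (m +₃ ⟦ σ ⟧))

opaque
  linePoint-difference : ∀ π w j m m′ → linePoint π w j m -ᵍ linePoint π w j m′ ≡ (m -₃ m′) ·ᵍ lineDirection π w
  linePoint-difference = from-yes (∀? λ π → ∀? λ w → ∀? λ j → ∀? λ m → ∀? λ m′ →
    linePoint π w j m -ᵍ linePoint π w j m′ ≟ᵍ (m -₃ m′) ·ᵍ lineDirection π w)

opaque
  on-plane-difference : ∀ s t C g h → OnPlane (s , t , C) g → OnPlane (s , t , C) h → InPlane s t (h -ᵍ g)
  on-plane-difference = from-yes (∀? λ s → ∀? λ t → ∀? λ C → ∀? λ g → ∀? λ h →
    onPlane? (s , t , C) g →-dec onPlane? (s , t , C) h →-dec inPlane? s t (h -ᵍ g))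

opaque
  parallel-planes-cover : ∀ π g → OnPlane π g ⊎ OnPlane (shift π one) g ⊎ OnPlane (shift π two) g
  parallel-planes-cover = from-yes (∀? λ π → ∀? λ g →
    onPlane? π g ⊎-dec onPlane? (shift π one) g ⊎-dec onPlane? (shift π two) g)

opaque
  parallel-planes-unique : ∀ π π₁ π₂ → (∀ g → OnPlane π g ⊎ OnPlane π₁ g ⊎ OnPlane π₂ g) →
    (π₁ ≡ shift π one × π₂ ≡ shift π two) ⊎ (π₁ ≡ shift π two × π₂ ≡ shift π one)
  parallel-planes-unique = from-yes (∀? λ π → ∀? λ π₁ → ∀? λ π₂ →
    (∀? λ g → onPlane? π g ⊎-dec onPlane? π₁ g ⊎-dec onPlane? π₂ g) →-dec
    ((π₁ ≟π shift π one ×-dec π₂ ≟π shift π two) ⊎-dec (π₁ ≟π shift π two ×-dec π₂ ≟π shift π one)))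

cells : List (F3 × F3)
cells = cartesianProduct (allFin 3) (allFin 3)

cells-complete : ∀ c → c ∈ cells
cells-complete (a , b) = ∈-cartesianProduct⁺ (∈-allFin a) (∈-allFin b)

planePoint : Plane → F3 × F3 → Grid
planePoint π (a , b) = a , b , height π a b

planePoint-on-plane : ∀ π c → OnPlane π (planePoint π c)
planePoint-on-plane π (a , b) = refl

planePoint-injective : ∀ π {c c′} → planePoint π c ≡ planePoint π c′ → c ≡ c′
planePoint-injective π {a , b} {.a , .b} refl = refl

Aligned : Grid → Grid → Set
Aligned (a , b , c) (a′ , b′ , c′) = (b ≡ b′ × c ≡ c′) ⊎ (a ≡ a′ × c ≡ c′) ⊎ (a ≡ a′ × b ≡ b′)

aligned? : ∀ g h → Dec (Aligned g h)
aligned? (a , b , c) (a′ , b′ , c′) =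
  (b ≟₃ b′ ×-dec c ≟₃ c′) ⊎-dec (a ≟₃ a′ ×-dec c ≟₃ c′) ⊎-dec (a ≟₃ a′ ×-dec b ≟₃ b′)

cellOf : Grid → F3 × F3
cellOf (a , b , _) = a , b

same-cell-aligned : ∀ g h → cellOf g ≡ cellOf h → Aligned g h
same-cell-aligned (a , b , _) (.a , .b , _) refl = inj₂ (inj₂ (refl , refl))

same-cell : ∀ g {a b} → cellOf g ≡ (a , b) → g ≡ (a , b , proj₂ (proj₂ g))
same-cell (a , b , _) refl = refl

_≟ᶜ_ : (c c′ : F3 × F3) → Dec (c ≡ c′)
_≟ᶜ_ = Productₚ.≡-dec _≟₃_ _≟₃_

cellsExcept : F3 × F3 → List (F3 × F3)
cellsExcept c = filter (λ d → ¬? (d ≟ᶜ c)) cells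

opaque
  cellsExcept-length : ∀ c → length (cellsExcept c) ≡ 8
  cellsExcept-length = from-yes (∀? λ c → length (cellsExcept c) Data.Nat.≟ 8)

opaque
  plane-unaligned : ∀ π g h → OnPlane π g → OnPlane π h → Aligned g h → g ≡ h
  plane-unaligned = from-yes (∀? λ π → ∀? λ g → ∀? λ h →
    onPlane? π g →-dec onPlane? π h →-dec aligned? g h →-dec g ≟ᵍ h)

Latin : (F3 → F3 → F3) → Set
Latin L = (∀ a b b′ → L a b ≡ L a b′ → b ≡ b′) × (∀ a a′ b → L a b ≡ L a′ b → a ≡ a′)

latin? : ∀ L → Dec (Latin L)
latin? L = (∀? λ a → ∀? λ b → ∀? λ b′ → (L a b ≟₃ L a b′) →-dec (b ≟₃ b′))
     ×-dec (∀? λ a → ∀? λ a′ → ∀? λ b → (L a b ≟₃ L a′ b) →-dec (a ≟₃ a′))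

private
  entry : Vec (Vec F3 3) 3 → F3 → F3 → F3
  entry L a b = lookup (lookup L a) b

  RowInjective : Vec F3 3 → Set
  RowInjective r = ∀ b b′ → lookup r b ≡ lookup r b′ → b ≡ b′

  rowInjective? : ∀ r → Dec (RowInjective r)
  rowInjective? r = ∀? λ b → ∀? λ b′ → (lookup r b ≟₃ lookup r b′) →-dec (b ≟₃ b′)

  -- Testing each row as soon as it is chosen keeps the search small.
  opaque
    latin-table-affine : ∀ r₀ → RowInjective r₀ → ∀ r₁ → RowInjective r₁ → ∀ r₂ → RowInjective r₂ →
                         let L = entry (r₀ ∷ r₁ ∷ r₂ ∷ []) in
                         Latin L → Σ[ s ∈ Sign ] Σ[ t ∈ Sign ] Σ[ C ∈ F3 ] ∀ a b → L a b ≡ height (s , t , C) a b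
    latin-table-affine = from-yes (
      ∀? λ r₀ → rowInjective? r₀ →-dec ∀? λ r₁ → rowInjective? r₁ →-dec ∀? λ r₂ → rowInjective? r₂ →-dec
      let L = entry (r₀ ∷ r₁ ∷ r₂ ∷ []) in
      latin? L →-dec ∃? λ s → ∃? λ t → ∃? λ C → ∀? λ a → ∀? λ b → L a b ≟₃ height (s , t , C) a b)

latin-affine : ∀ L → Latin L → Σ Plane λ π → ∀ a b → L a b ≡ height π a b
latin-affine L (rows , columns) =
  let s , t , C , fits = latin-table-affine _ (table-rows zero) _ (table-rows one) _ (table-rows two)
                                            (table-rows , table-columns)
  in  (s , t , C) , λ a b → trans (sym (entry-table a b)) (fits a b)
  where
  table : Vec (Vec F3 3) 3
  table = tabulate λ a → tabulate (L a)

  entry-table : ∀ a b → entry table a b ≡ L a b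
  entry-table a b = trans (cong (λ row → lookup row b) (Vecₚ.lookup∘tabulate (λ a → tabulate (L a)) a))
                          (Vecₚ.lookup∘tabulate (L a) b)

  table-rows : ∀ a b b′ → entry table a b ≡ entry table a b′ → b ≡ b′
  table-rows a b b′ same = rows a b b′ (trans (sym (entry-table a b)) (trans same (entry-table a b′)))

  table-columns : ∀ a a′ b → entry table a b ≡ entry table a′ b → a ≡ a′
  table-columns a a′ b same = columns a a′ b (trans (sym (entry-table a b)) (trans same (entry-table a′ b)))

-- The Segre variety as the image of the grid

module Embedding (φ : Tensor → V8) (φ-linear : Linear φ) (φ-bijective : Bijective _≡_ _≡_ φ)
                 (segre⊆ω4 : Segre φ ⊆ ω4) where

  opaque
    pt : Grid → V8
    pt g = φ (pure g)

    pt-def : ∀ g → pt g ≡ φ (pure g)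
    pt-def g = refl

  pt-injective : ∀ {g h} → pt g ≡ pt h → g ≡ h
  pt-injective {g} {h} pt-g≡pt-h =
    pure-injective g h (proj₁ φ-bijective (trans (sym (pt-def g)) (trans pt-g≡pt-h (pt-def h))))

  pt∈segre : ∀ g → Segre φ (pt g)
  pt∈segre g@(a , b , c) = pure g , (nz a , nz b , nz c , refl) , pure≢0 g , pt-def g

  segre⇒pt : ∀ {x} → Segre φ x → Σ Grid λ g → x ≡ pt g
  segre⇒pt (T , (y₁ , y₂ , y₃ , refl) , T≢0 , refl) =
    let g , T≡pure-g = pure-tensor y₁ y₂ y₃ T≢0 in g , trans (cong φ T≡pure-g) (sym (pt-def g))

  pt-components : ∀ i g → NonZero (component i (pt g))
  pt-components i g = ω4-components (pt g) (segre⊆ω4 (pt∈segre g)) i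

  ψ : Fin 4 → Tensor → Pair
  ψ i = component i ∘ φ

  ψ-additive : ∀ i → Additive (ψ i)
  ψ-additive i S T = trans (cong (component i) (φ-linear S T)) (component-⊕ i (φ S) (φ T))

  labelling : Fin 4 → Affine
  labelling i = proj₁ (affine-label (ψ i) (ψ-additive i) λ g → subst (NonZero ∘ component i) (pt-def g) (pt-components i g))

  label-pt : ∀ i g → label (component i (pt g)) ≡ labelling i ⟨ g ⟩
  label-pt i g = subst (λ x → label (component i x) ≡ labelling i ⟨ g ⟩) (sym (pt-def g))
                       (proj₂ (affine-label (ψ i) (ψ-additive i) ψ-pure≢0) g)
    where
    ψ-pure≢0 : ∀ g → NonZero (ψ i (pure g))
    ψ-pure≢0 g = subst (NonZero ∘ component i) (pt-def g) (pt-components i g)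

  component-pt : ∀ i g → component i (pt g) ≡ orbit (labelling i ⟨ g ⟩)
  component-pt i g = trans (sym (orbit-label _ (pt-components i g))) (cong orbit (label-pt i g))

  row : Fin 4 → Form
  row = proj₁ ∘ labelling

  E : SignMatrix
  E = tabulate row

  labels : Grid → F34
  labels g = tabulate λ i → labelling i ⟨ g ⟩

  coordinates-pt : ∀ g → coordinates (pt g) ≡ labels g
  coordinates-pt g = Vecₚ.tabulate-cong λ i → label-pt i g

  pt≡p : ∀ g → pt g ≡ p (labels g)
  pt≡p g = trans (sym (p-coordinates (pt g) (λ i → pt-components i g))) (cong p (coordinates-pt g))

  HD-pt⇔weight : ∀ g h → HD (pt g) (pt h) 3 ⇔ weight (E ⊛ (g -ᵍ h)) ≡ 3
  HD-pt⇔weight g h = mk⇔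
    (λ hd → subst (λ μ → weight μ ≡ 3) labels-difference
              (Equivalence.to (HD-p⇔weight (labels g) (labels h) 3) (subst₂ (λ x y → HD x y 3) (pt≡p g) (pt≡p h) hd)))
    (λ weight≡3 → subst₂ (λ x y → HD x y 3) (sym (pt≡p g)) (sym (pt≡p h))
                    (Equivalence.from (HD-p⇔weight (labels g) (labels h) 3)
                                      (subst (λ μ → weight μ ≡ 3) (sym labels-difference) weight≡3)))
    where
    labels-difference : labels g -v labels h ≡ E ⊛ (g -ᵍ h)
    labels-difference = Vecₚ.tabulate-cong λ i → affine-difference (labelling i) g h

  -- If row j were ± row i, component j of φ would be a function of component i, contradicting surjectivity.
  rows-not-proportional : ∀ i j → i ≢ j → ¬ Proportional (row i) (row j)
  rows-not-proportional i j i≢j proportional = contradiction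
    where
    kᵢ kⱼ : F3
    kᵢ = proj₂ (labelling i)
    kⱼ = proj₂ (labelling j)

    σ = proj₁ (proportional⇒scaled (row i) (row j) proportional)
    scaled = proj₂ (proportional⇒scaled (row i) (row j) proportional)
    τ = relabel σ kᵢ kⱼ

    τψ-additive : Additive (τ ∘ ψ i)
    τψ-additive S T = trans (cong τ (ψ-additive i S T)) (relabel-additive σ kᵢ kⱼ (ψ i S) (ψ i T))

    on-basis : ∀ g → ψ j (pure g) ≡ τ (ψ i (pure g))
    on-basis g = begin
      ψ j (pure g)                                           ≡⟨ cong (component j) (sym (pt-def g)) ⟩
      component j (pt g)                                     ≡⟨ component-pt j g ⟩
      orbit ((row j ∙ g) +₃ kⱼ)                              ≡⟨ cong (λ v → orbit (v +₃ kⱼ)) (scaled g) ⟩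
      orbit ((⟦ σ ⟧ *₃ (row i ∙ g)) +₃ kⱼ)                  ≡⟨ cong (λ v → orbit ((⟦ σ ⟧ *₃ v) +₃ kⱼ))
                                                                      (sym (-₃-+₃ (row i ∙ g) kᵢ)) ⟩
      orbit ((⟦ σ ⟧ *₃ (labelling i ⟨ g ⟩ -₃ kᵢ)) +₃ kⱼ)    ≡⟨ cong (λ v → orbit ((⟦ σ ⟧ *₃ (v -₃ kᵢ)) +₃ kⱼ))
                                                                      (sym (label-pt i g)) ⟩
      orbit ((⟦ σ ⟧ *₃ (label (component i (pt g)) -₃ kᵢ)) +₃ kⱼ)
                                                              ≡⟨ sym (relabel-nonzero σ kᵢ kⱼ _ (pt-components i g)) ⟩
      τ (component i (pt g))                                  ≡⟨ cong (τ ∘ component i) (pt-def g) ⟩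
      τ (ψ i (pure g))                                        ∎
      where open ≡-Reasoning

    T₀ = proj₁ (proj₂ φ-bijective (single j (true , false)))
    φT₀≡ : φ T₀ ≡ single j (true , false)
    φT₀≡ = proj₂ (proj₂ φ-bijective (single j (true , false))) refl

    e₁≡0 : (true , false) ≡ 0ₚ
    e₁≡0 = begin
      true , false                                ≡⟨ sym (component-single-same j (true , false)) ⟩
      component j (single j (true , false))       ≡⟨ cong (component j) (sym φT₀≡) ⟩
      ψ j T₀                                      ≡⟨ additive-unique {ψ j} {τ ∘ ψ i} (ψ-additive j) τψ-additive
                                                       (λ (a , b , c) → on-basis (ι a , ι b , ι c)) T₀ ⟩
      τ (ψ i T₀)                                  ≡⟨ cong (τ ∘ component i) φT₀≡ ⟩
      τ (component i (single j (true , false)))   ≡⟨ cong τ (component-single-other i j (true , false) i≢j) ⟩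
      0ₚ                                          ∎
      where open ≡-Reasoning

    contradiction : ⊥
    contradiction with e₁≡0
    ... | ()

  independent : Independent E
  independent =
      (rows-not-proportional zero (suc zero) (λ ()) ∷ rows-not-proportional zero (suc (suc zero)) (λ ())
         ∷ rows-not-proportional zero (suc (suc (suc zero))) (λ ()) ∷ [])
    ∷ (rows-not-proportional (suc zero) (suc (suc zero)) (λ ())
         ∷ rows-not-proportional (suc zero) (suc (suc (suc zero))) (λ ()) ∷ [])
    ∷ (rows-not-proportional (suc (suc zero)) (suc (suc (suc zero))) (λ ()) ∷ [])
    ∷ [] ∷ []

  pt-factors : ∀ g x y z → pt g ≡ φ (x ⊗ y ⊗ z) → x ≢ 0₂ → y ≢ 0₂ → z ≢ 0₂ →
               Σ[ a ∈ F3 ] Σ[ b ∈ F3 ] Σ[ c ∈ F3 ] (x ≡ nz a × y ≡ nz b × z ≡ nz c × g ≡ (a , b , c))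
  pt-factors g x y z pt-g≡ x≢0 y≢0 z≢0 with nz-onto x x≢0 | nz-onto y y≢0 | nz-onto z z≢0
  ... | a , refl | b , refl | c , refl = a , b , c , refl , refl , refl , pt-injective (trans pt-g≡ (sym (pt-def (a , b , c))))

  generator⇒aligned : ∀ g h → OnCommonGenerator φ (pt g) (pt h) → Aligned g h
  generator⇒aligned g h (_ , (y , z , y≢0 , z≢0 , inj₁ (⊆line , _)) , ∈g , ∈h)
    with ⊆line ∈g | ⊆line ∈h
  ... | x , x≢0 , eg | x′ , x′≢0 , eh
    with pt-factors g x y z eg x≢0 y≢0 z≢0 | pt-factors h x′ y z eh x′≢0 y≢0 z≢0
  ... | _ , b , c , _ , y≡b , z≡c , refl | _ , b′ , c′ , _ , y≡b′ , z≡c′ , refl =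
    inj₁ (nz-injective (trans (sym y≡b) y≡b′) , nz-injective (trans (sym z≡c) z≡c′))
  generator⇒aligned g h (_ , (y , z , y≢0 , z≢0 , inj₂ (inj₁ (⊆line , _))) , ∈g , ∈h)
    with ⊆line ∈g | ⊆line ∈h
  ... | x , x≢0 , eg | x′ , x′≢0 , eh
    with pt-factors g y x z eg y≢0 x≢0 z≢0 | pt-factors h y x′ z eh y≢0 x′≢0 z≢0
  ... | a , _ , c , y≡a , _ , z≡c , refl | a′ , _ , c′ , y≡a′ , _ , z≡c′ , refl =
    inj₂ (inj₁ (nz-injective (trans (sym y≡a) y≡a′) , nz-injective (trans (sym z≡c) z≡c′)))
  generator⇒aligned g h (_ , (y , z , y≢0 , z≢0 , inj₂ (inj₂ (⊆line , _))) , ∈g , ∈h)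
    with ⊆line ∈g | ⊆line ∈h
  ... | x , x≢0 , eg | x′ , x′≢0 , eh
    with pt-factors g y z x eg y≢0 z≢0 x≢0 | pt-factors h y z x′ eh y≢0 z≢0 x′≢0
  ... | a , b , _ , y≡a , z≡b , _ , refl | a′ , b′ , _ , y≡a′ , z≡b′ , _ , refl =
    inj₂ (inj₂ (nz-injective (trans (sym y≡a) y≡a′) , nz-injective (trans (sym z≡b) z≡b′)))

  aligned⇒generator : ∀ g h → Aligned g h → OnCommonGenerator φ (pt g) (pt h)
  aligned⇒generator (a , b , c) (a′ , _ , _) (inj₁ (refl , refl)) =
    (λ v → Σ[ x ∈ V2 ] (x ≢ 0₂ × v ≡ φ (x ⊗ nz b ⊗ nz c))) ,
    (nz b , nz c , nz≢0 b , nz≢0 c , inj₁ ≐-refl) , (nz a , nz≢0 a , pt-def _) , (nz a′ , nz≢0 a′ , pt-def _)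
  aligned⇒generator (a , b , c) (_ , b′ , _) (inj₂ (inj₁ (refl , refl))) =
    (λ v → Σ[ x ∈ V2 ] (x ≢ 0₂ × v ≡ φ (nz a ⊗ x ⊗ nz c))) ,
    (nz a , nz c , nz≢0 a , nz≢0 c , inj₂ (inj₁ ≐-refl)) , (nz b , nz≢0 b , pt-def _) , (nz b′ , nz≢0 b′ , pt-def _)
  aligned⇒generator (a , b , c) (_ , _ , c′) (inj₂ (inj₂ (refl , refl))) =
    (λ v → Σ[ x ∈ V2 ] (x ≢ 0₂ × v ≡ φ (nz a ⊗ nz b ⊗ x))) ,
    (nz a , nz b , nz≢0 a , nz≢0 b , inj₂ (inj₂ ≐-refl)) , (nz c , nz≢0 c , pt-def _) , (nz c′ , nz≢0 c′ , pt-def _)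

  planeFan : Plane → Subset8
  planeFan π x = Σ Grid λ g → OnPlane π g × x ≡ pt g

  planeFan-fan : ∀ π → Fan φ (planeFan π)
  planeFan-fan π = (λ { (g , _ , refl) → pt∈segre g }) , (points , unique , size , membership) , unaligned
    where
    points : List V8
    points = map (pt ∘ planePoint π) cells

    unique : Unique points
    unique = Uniqueₚ.map⁺ {f = pt ∘ planePoint π} (planePoint-injective π ∘ pt-injective)
                          (Uniqueₚ.cartesianProduct⁺ (Uniqueₚ.allFin⁺ 3) (Uniqueₚ.allFin⁺ 3))

    size : length points ≡ 9
    size = length-map (pt ∘ planePoint π) cells

    membership : ∀ v → v ∈ points ⇔ planeFan π v
    membership v = mk⇔ to from
      where
      to : v ∈ points → planeFan π v
      to v∈ with ∈-map⁻ (pt ∘ planePoint π) {xs = cells} v∈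
      ... | c , _ , v≡ = planePoint π c , planePoint-on-plane π c , v≡

      from : planeFan π v → v ∈ points
      from ((a , b , _) , refl , refl) = ∈-map⁺ (pt ∘ planePoint π) (cells-complete (a , b))

    unaligned : ∀ x y → planeFan π x → planeFan π y → x ≢ y → ¬ OnCommonGenerator φ x y
    unaligned _ _ (g , g∈π , refl) (h , h∈π , refl) pt-g≢pt-h common =
      pt-g≢pt-h (cong pt (plane-unaligned π g h g∈π h∈π (generator⇒aligned g h common)))

  opaque
    preimage : V8 → Grid
    preimage x with ∃? (λ g → x ≟⁸ pt g)
    ... | yes (g , _) = g
    ... | no _        = 0ᵍ

    segre⇒preimage : ∀ {x} → Segre φ x → x ≡ pt (preimage x)
    segre⇒preimage {x} x∈S with ∃? (λ g → x ≟⁸ pt g)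
    ... | yes (_ , x≡pt-g) = x≡pt-g
    ... | no  ∄g           = ⊥-elim (∄g (segre⇒pt x∈S))

  -- A fan meets every vertical line of the grid exactly once, so it is the graph of a Latin square,
  -- hence of an affine plane.
  module FanIsPlane (F : Subset8) (fan : Fan φ F) where
    open Data.List.Membership.DecPropositional _≟ᶜ_ using (_∈?_)

    xs : List V8
    xs = proj₁ (proj₁ (proj₂ fan))

    xs⇔F : ∀ x → x ∈ xs ⇔ F x
    xs⇔F = proj₂ (proj₂ (proj₂ (proj₁ (proj₂ fan))))

    no-generator : ∀ x y → F x → F y → x ≢ y → ¬ OnCommonGenerator φ x y
    no-generator = proj₂ (proj₂ fan)

    x≡pt : ∀ {x} → F x → x ≡ pt (preimage x)
    x≡pt x∈F = segre⇒preimage (proj₁ fan x∈F)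

    cell : V8 → F3 × F3
    cell = cellOf ∘ preimage

    distinct-cells : ∀ x y → F x → F y → x ≢ y → cell x ≢ cell y
    distinct-cells x y x∈F y∈F x≢y same =
      no-generator x y x∈F y∈F x≢y (subst₂ (OnCommonGenerator φ) (sym (x≡pt x∈F)) (sym (x≡pt y∈F))
        (aligned⇒generator _ _ (same-cell-aligned (preimage x) (preimage y) same)))

    unique-cells : Unique (map cell xs)
    unique-cells = AllPairsₚ.map⁺ (allPairs-map-on (λ {x} {y} x∈F y∈F → distinct-cells x y x∈F y∈F)
                                                 (All.tabulate λ {x} x∈xs → Equivalence.to (xs⇔F x) x∈xs)
                                                 (proj₁ (proj₂ (proj₁ (proj₂ fan)))))

    -- Otherwise the nine distinct cells of F would all lie among the eight other cells.
    every-cell : ∀ c → c ∈ map cell xs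
    every-cell c with c ∈? map cell xs
    ... | yes c∈ = c∈
    ... | no  c∉ = ⊥-elim (ℕₚ.<-irrefl refl (subst₂ _≤_ nine (cellsExcept-length c)
                             (unique-⊆-length unique-cells λ {d} d∈ → ∈-filter⁺ (λ d → ¬? (d ≟ᶜ c)) (cells-complete d)
                                                                        λ { refl → c∉ d∈ })))
      where
      nine : length (map cell xs) ≡ 9
      nine = trans (length-map cell xs) (proj₁ (proj₂ (proj₂ (proj₁ (proj₂ fan)))))

    witness : F3 × F3 → V8
    witness c = proj₁ (∈-map⁻ cell (every-cell c))

    witness∈F : ∀ c → F (witness c)
    witness∈F c = Equivalence.to (xs⇔F _) (proj₁ (proj₂ (∈-map⁻ cell (every-cell c))))

    witness-cell : ∀ c → cell (witness c) ≡ c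
    witness-cell c = sym (proj₂ (proj₂ (∈-map⁻ cell (every-cell c))))

    L : F3 → F3 → F3
    L a b = proj₂ (proj₂ (preimage (witness (a , b))))

    preimage-witness : ∀ a b → preimage (witness (a , b)) ≡ (a , b , L a b)
    preimage-witness a b = same-cell _ (witness-cell (a , b))

    witness-injective : ∀ {c c′} → witness c ≡ witness c′ → c ≡ c′
    witness-injective {c} {c′} same = trans (sym (witness-cell c)) (trans (cong cell same) (witness-cell c′))

    -- Two witnesses agreeing in a further coordinate would lie on a common generator.
    witnesses-unaligned : ∀ c c′ → Aligned (preimage (witness c)) (preimage (witness c′)) → c ≡ c′
    witnesses-unaligned c c′ aligned with c ≟ᶜ c′
    ... | yes c≡c′ = c≡c′
    ... | no  c≢c′ = ⊥-elim (no-generator _ _ (witness∈F c) (witness∈F c′) (c≢c′ ∘ witness-injective)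
                       (subst₂ (OnCommonGenerator φ) (sym (x≡pt (witness∈F c))) (sym (x≡pt (witness∈F c′)))
                         (aligned⇒generator _ _ aligned)))

    latin : Latin L
    latin = (λ a b b′ same → cong proj₂ (witnesses-unaligned (a , b) (a , b′)
               (subst₂ Aligned (sym (preimage-witness a b)) (sym (preimage-witness a b′)) (inj₂ (inj₁ (refl , same))))))
          , (λ a a′ b same → cong proj₁ (witnesses-unaligned (a , b) (a′ , b)
               (subst₂ Aligned (sym (preimage-witness a b)) (sym (preimage-witness a′ b)) (inj₁ (refl , same)))))

    plane : Plane
    plane = proj₁ (latin-affine L latin)

    L≡height : ∀ a b → L a b ≡ height plane a b
    L≡height = proj₂ (latin-affine L latin)

    F≐plane : F ≐ planeFan plane
    F≐plane = F⊆ , ⊆F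
      where
      x≡witness : ∀ {x} → F x → x ≡ witness (cell x)
      x≡witness {x} x∈F with x ≟⁸ witness (cell x)
      ... | yes x≡ = x≡
      ... | no  x≢ = ⊥-elim (distinct-cells x _ x∈F (witness∈F (cell x)) x≢ (sym (witness-cell (cell x))))

      F⊆ : F ⊆ planeFan plane
      F⊆ {x} x∈F = preimage x , on-plane , x≡pt x∈F
        where
        on-plane : OnPlane plane (preimage x)
        on-plane = subst (OnPlane plane) (sym (trans (cong preimage (x≡witness x∈F)) (preimage-witness _ _)))
                         (L≡height _ _)

      ⊆F : planeFan plane ⊆ F
      ⊆F ((a , b , _) , refl , refl) =
        subst F (trans (x≡pt (witness∈F (a , b))) (cong pt (trans (preimage-witness a b) (cong (λ v → a , b , v) (L≡height a b)))))
              (witness∈F (a , b))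

  opaque
    fan-plane : ∀ F → Fan φ F → Σ Plane λ π → F ≐ planeFan π
    fan-plane F fan = FanIsPlane.plane F fan , FanIsPlane.F≐plane F fan

  planeFan⇒on-plane : ∀ π g → planeFan π (pt g) → OnPlane π g
  planeFan⇒on-plane π g (h , h∈π , pt-g≡pt-h) = subst (OnPlane π) (sym (pt-injective pt-g≡pt-h)) h∈π

  planeFan⊆segre : ∀ π → planeFan π ⊆ Segre φ
  planeFan⊆segre π (g , _ , refl) = pt∈segre g

  -- Troikas and centres

  module ParallelPlanes (s t : Sign) where
    private
      profile = plane-profile E independent s t
    open PlaneProfile profile

    π : F3 → Plane
    π C = s , t , C

    point : F3 → F3 → F3 → V8
    point C j m = pt (linePoint (π C) w j m)

    troika : F3 → F3 → Subset8
    troika C j = set3 (point C j zero) (point C j one) (point C j two)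

    point∈troika : ∀ C j m → troika C j (point C j m)
    point∈troika C j zero             = inj₁ refl
    point∈troika C j (suc zero)       = inj₂ (inj₁ refl)
    point∈troika C j (suc (suc zero)) = inj₂ (inj₂ refl)

    troika⇒point : ∀ C j {y} → troika C j y → Σ F3 λ m → y ≡ point C j m
    troika⇒point C j (inj₁ y≡)        = zero , y≡
    troika⇒point C j (inj₂ (inj₁ y≡)) = one , y≡
    troika⇒point C j (inj₂ (inj₂ y≡)) = two , y≡

    point-injective : ∀ C j m j′ m′ → point C j m ≡ point C j′ m′ → j ≡ j′ × m ≡ m′
    point-injective C j m j′ m′ = linePoint-injective (π C) w j m j′ m′ ∘ pt-injective

    point≢ : ∀ C j m m′ → m ≢ m′ → point C j m ≢ point C j m′
    point≢ C j m m′ m≢m′ = m≢m′ ∘ proj₂ ∘ point-injective C j m j m′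

    point∈plane : ∀ C j m → planeFan (π C) (point C j m)
    point∈plane C j m = linePoint (π C) w j m , linePoint-on-plane (π C) w j m , refl

    point-HD : ∀ C j m m′ → m ≢ m′ → HD (point C j m) (point C j m′) 3
    point-HD C j m m′ m≢m′ = Equivalence.from (HD-pt⇔weight (linePoint (π C) w j m) (linePoint (π C) w j m′)) (begin
      weight (E ⊛ (linePoint (π C) w j m -ᵍ linePoint (π C) w j m′))
                                                      ≡⟨ cong (weight ∘ (E ⊛_)) (linePoint-difference (π C) w j m m′) ⟩
      weight (E ⊛ ((m -₃ m′) ·ᵍ direction s t w))    ≡⟨ cong (λ u → weight (E ⊛ (u ·ᵍ direction s t w))) m-m′≡σ ⟩
      weight (E ⊛ (⟦ σ ⟧ ·ᵍ direction s t w))        ≡⟨ weight-unit σ ⟩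
      weight (E ⊛ direction s t w)                    ≡⟨ weight-w ⟩
      3                                               ∎)
      where
      open ≡-Reasoning
      σ = proj₁ (difference-unit m m′ m≢m′)
      m-m′≡σ = proj₂ (difference-unit m m′ m≢m′)
      weight-unit : ∀ σ → weight (E ⊛ (⟦ σ ⟧ ·ᵍ direction s t w)) ≡ weight (E ⊛ direction s t w)
      weight-unit false = cong (weight ∘ (E ⊛_)) (·ᵍ-one _)
      weight-unit true  = trans (cong (weight ∘ (E ⊛_)) (·ᵍ-two _)) (weight-⊛-negate E _)

    troika-troika : ∀ C j → Troika φ (troika C j)
    troika-troika C j =
      troika⊆segre , HasSize-set3 (point≢ C j zero one λ ()) (point≢ C j zero two λ ()) (point≢ C j one two λ ()) ,
      pairwise-HD
      where
      troika⊆segre : troika C j ⊆ Segre φ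
      troika⊆segre y∈ = let m , y≡ = troika⇒point C j y∈ in subst (Segre φ) (sym y≡) (pt∈segre (linePoint (π C) w j m))

      pairwise-HD : ∀ a b → troika C j a → troika C j b → a ≢ b → HD a b 3
      pairwise-HD _ _ a∈ b∈ a≢b =
        let m , a≡ = troika⇒point C j a∈ ; m′ , b≡ = troika⇒point C j b∈
        in  subst₂ (λ a b → HD a b 3) (sym a≡) (sym b≡)
                   (point-HD C j m m′ λ m≡m′ → a≢b (trans a≡ (trans (cong (point C j) m≡m′) (sym b≡))))

    plane-split : ∀ C → planeFan (π C) ≐ (troika C zero ∪ (troika C one ∪ troika C two))
    plane-split C = split , join
      where
      point∈troikas : ∀ j m → (troika C zero ∪ (troika C one ∪ troika C two)) (point C j m)
      point∈troikas zero             m = inj₁ (point∈troika C zero m)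
      point∈troikas (suc zero)       m = inj₂ (inj₁ (point∈troika C one m))
      point∈troikas (suc (suc zero)) m = inj₂ (inj₂ (point∈troika C two m))

      split : planeFan (π C) ⊆ (troika C zero ∪ (troika C one ∪ troika C two))
      split (g , g∈π , y≡pt-g) =
        let j , m , g≡ = linePoint-onto (π C) w g g∈π
        in  subst (troika C zero ∪ (troika C one ∪ troika C two)) (sym (trans y≡pt-g (cong pt g≡))) (point∈troikas j m)

      troika⊆plane : ∀ j → troika C j ⊆ planeFan (π C)
      troika⊆plane j y∈ = let m , y≡ = troika⇒point C j y∈ in subst (planeFan (π C)) (sym y≡) (point∈plane C j m)

      join : (troika C zero ∪ (troika C one ∪ troika C two)) ⊆ planeFan (π C)
      join (inj₁ y∈)        = troika⊆plane zero y∈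
      join (inj₂ (inj₁ y∈)) = troika⊆plane one y∈
      join (inj₂ (inj₂ y∈)) = troika⊆plane two y∈

    neighbour : ∀ C j m g → OnPlane (π C) g → pt g ≢ point C j m → HD (pt g) (point C j m) 3 →
                Σ Sign λ σ → g ≡ linePoint (π C) w j (m +₃ ⟦ σ ⟧)
    neighbour C j m g g∈π g≢ distance-3 =
      step (weight-3-direction profile d (on-plane-difference s t C origin g (linePoint-on-plane (π C) w j m) g∈π) d≢0
                               (Equivalence.to (HD-pt⇔weight g origin) distance-3))
      where
      origin = linePoint (π C) w j m
      d = g -ᵍ origin

      g≡ : g ≡ origin +ᵍ d
      g≡ = sym (+ᵍ-difference origin g)

      d≢0 : d ≢ 0ᵍ
      d≢0 d≡0 = g≢ (cong pt (trans g≡ (trans (cong (origin +ᵍ_) d≡0) (+ᵍ-0 origin))))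

      step : d ≡ direction s t w ⊎ d ≡ -ᵍ direction s t w → Σ Sign λ σ → g ≡ linePoint (π C) w j (m +₃ ⟦ σ ⟧)
      step (inj₁ d≡) =
        false , trans g≡ (trans (cong (origin +ᵍ_) (trans d≡ (sym (·ᵍ-one _)))) (linePoint-step (π C) w j m false))
      step (inj₂ d≡) =
        true , trans g≡ (trans (cong (origin +ᵍ_) (trans d≡ (sym (·ᵍ-two _)))) (linePoint-step (π C) w j m true))

    triple-on-line : ∀ C y₁ y₂ y₃ → planeFan (π C) y₁ → planeFan (π C) y₂ → planeFan (π C) y₃ →
                     y₁ ≢ y₂ → y₁ ≢ y₃ → y₂ ≢ y₃ → HD y₂ y₁ 3 → HD y₃ y₁ 3 →
                     Σ F3 λ j → set3 y₁ y₂ y₃ ≐ troika C j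
    triple-on-line C _ _ _ (g₁ , g₁∈π , refl) (g₂ , g₂∈π , refl) (g₃ , g₃∈π , refl)
                   y₁≢y₂ y₁≢y₃ y₂≢y₃ hd₂ hd₃ =
      j , ⊆troika , troika⊆
      where
      j  = proj₁ (linePoint-onto (π C) w g₁ g₁∈π)
      m₁ = proj₁ (proj₂ (linePoint-onto (π C) w g₁ g₁∈π))

      y₁≡ : pt g₁ ≡ point C j m₁
      y₁≡ = cong pt (proj₂ (proj₂ (linePoint-onto (π C) w g₁ g₁∈π)))

      neighbour-of-y₁ : ∀ g → OnPlane (π C) g → pt g₁ ≢ pt g → HD (pt g) (pt g₁) 3 →
                        Σ Sign λ σ → pt g ≡ point C j (m₁ +₃ ⟦ σ ⟧)
      neighbour-of-y₁ g g∈π y₁≢ hd =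
        let σ , g≡ = neighbour C j m₁ g g∈π (λ y≡ → y₁≢ (trans y₁≡ (sym y≡)))
                               (subst (λ y → HD (pt g) y 3) y₁≡ hd)
        in  σ , cong pt g≡

      σ₂ = proj₁ (neighbour-of-y₁ g₂ g₂∈π y₁≢y₂ hd₂)
      σ₃ = proj₁ (neighbour-of-y₁ g₃ g₃∈π y₁≢y₃ hd₃)
      y₂≡ = proj₂ (neighbour-of-y₁ g₂ g₂∈π y₁≢y₂ hd₂)
      y₃≡ = proj₂ (neighbour-of-y₁ g₃ g₃∈π y₁≢y₃ hd₃)

      σ₂≢σ₃ : σ₂ ≢ σ₃
      σ₂≢σ₃ σ₂≡σ₃ = y₂≢y₃ (trans y₂≡ (trans (cong (λ σ → point C j (m₁ +₃ ⟦ σ ⟧)) σ₂≡σ₃) (sym y₃≡)))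

      ⊆troika : set3 (pt g₁) (pt g₂) (pt g₃) ⊆ troika C j
      ⊆troika (inj₁ refl)        = subst (troika C j) (sym y₁≡) (point∈troika C j m₁)
      ⊆troika (inj₂ (inj₁ refl)) = subst (troika C j) (sym y₂≡) (point∈troika C j (m₁ +₃ ⟦ σ₂ ⟧))
      ⊆troika (inj₂ (inj₂ refl)) = subst (troika C j) (sym y₃≡) (point∈troika C j (m₁ +₃ ⟦ σ₃ ⟧))

      on-triple : ∀ m → m ≡ m₁ ⊎ m ≡ m₁ +₃ ⟦ σ₂ ⟧ ⊎ m ≡ m₁ +₃ ⟦ σ₃ ⟧ →
                  set3 (pt g₁) (pt g₂) (pt g₃) (point C j m)
      on-triple m (inj₁ m≡)        = inj₁ (trans (cong (point C j) m≡) (sym y₁≡))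
      on-triple m (inj₂ (inj₁ m≡)) = inj₂ (inj₁ (trans (cong (point C j) m≡) (sym y₂≡)))
      on-triple m (inj₂ (inj₂ m≡)) = inj₂ (inj₂ (trans (cong (point C j) m≡) (sym y₃≡)))

      troika⊆ : troika C j ⊆ set3 (pt g₁) (pt g₂) (pt g₃)
      troika⊆ y∈ = let m , y≡ = troika⇒point C j y∈
                   in  subst (set3 (pt g₁) (pt g₂) (pt g₃)) (sym y≡) (on-triple m (line-covers m₁ σ₂ σ₃ σ₂≢σ₃ m))

    troika-in-plane : ∀ C T → Troika φ T → T ⊆ planeFan (π C) → Σ F3 λ j → T ≐ troika C j
    troika-in-plane C T (_ , size , distance-3) T⊆π =
      let y₁ , y₂ , y₃ , y₁≢y₂ , y₁≢y₃ , y₂≢y₃ , T≐ = HasSize-3 size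
          y∈T : ∀ {y} → set3 y₁ y₂ y₃ y → T y
          y∈T = proj₂ T≐
          j , on-line = triple-on-line C y₁ y₂ y₃ (T⊆π (y∈T (inj₁ refl))) (T⊆π (y∈T (inj₂ (inj₁ refl))))
                          (T⊆π (y∈T (inj₂ (inj₂ refl)))) y₁≢y₂ y₁≢y₃ y₂≢y₃
                          (distance-3 y₂ y₁ (y∈T (inj₂ (inj₁ refl))) (y∈T (inj₁ refl)) (y₁≢y₂ ∘ sym))
                          (distance-3 y₃ y₁ (y∈T (inj₂ (inj₂ refl))) (y∈T (inj₁ refl)) (y₁≢y₃ ∘ sym))
      in  j , ≐-trans T≐ on-line

    row-x-vanishes : ∀ w′ → row x ∙ direction s t w′ ≡ zero
    row-x-vanishes w′ = subst (λ r → r ∙ direction s t w′ ≡ zero) (Vecₚ.lookup∘tabulate row x) (x-vanishes w′)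

    only-row-x-vanishes : ∀ i → row i ∙ direction s t w ≡ zero → i ≡ x
    only-row-x-vanishes i = only-x-vanishes i ∘ subst (λ r → r ∙ direction s t w ≡ zero) (sym (Vecₚ.lookup∘tabulate row i))

    centre : F3 → V8
    centre C = single x (orbit (labelling x ⟨ zero , zero , C ⟩))

    component-point : ∀ C i j m → component i (point C j m)
                                   ≡ orbit (labelling i ⟨ lineBase (π C) w j ⟩ +₃ (m *₃ (row i ∙ direction s t w)))
    component-point C i j m = trans (component-pt i (linePoint (π C) w j m))
                                    (cong orbit (affine-along (labelling i) (lineBase (π C) w j) m (direction s t w)))

    component-troika-sum : ∀ C i j → component i ((point C j zero ⊕ point C j one) ⊕ point C j two)
                                     ≡ orbitSum (labelling i ⟨ lineBase (π C) w j ⟩) (row i ∙ direction s t w)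
    component-troika-sum C i j = begin
      component i ((point C j zero ⊕ point C j one) ⊕ point C j two)
        ≡⟨ component-⊕ i _ _ ⟩
      component i (point C j zero ⊕ point C j one) ⊕ₚ component i (point C j two)
        ≡⟨ cong (_⊕ₚ component i (point C j two)) (component-⊕ i _ _) ⟩
      component i (point C j zero) ⊕ₚ component i (point C j one) ⊕ₚ component i (point C j two)
        ≡⟨ cong₂ _⊕ₚ_ (cong₂ _⊕ₚ_ (component-point C i j zero) (component-point C i j one)) (component-point C i j two) ⟩
      orbitSum (labelling i ⟨ lineBase (π C) w j ⟩) (row i ∙ direction s t w)
        ∎
      where open ≡-Reasoning

    -- Only the row x vanishing on the plane survives in the sum, and it is constant on the plane.
    troika-centre : ∀ C j → IsCentre (troika C j) (centre C)
    troika-centre C j =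
      point C j zero , point C j one , point C j two ,
      point≢ C j zero one (λ ()) , point≢ C j zero two (λ ()) , point≢ C j one two (λ ()) , ≐-refl ,
      component-ext _ _ λ i → same-component i (i Finₚ.≟ x)
      where
      base slope : Fin 4 → F3
      base i = labelling i ⟨ lineBase (π C) w j ⟩
      slope i = row i ∙ direction s t w

      vanishing-row-constant : base x ≡ labelling x ⟨ zero , zero , C ⟩
      vanishing-row-constant =
        trans (affine-along (labelling x) (zero , zero , C) j (direction s t (complement w)))
              (trans (cong (λ v → labelling x ⟨ zero , zero , C ⟩ +₃ (j *₃ v)) (row-x-vanishes (complement w)))
                     (+₃-*₃-zero _ j))

      same-component : ∀ i → Dec (i ≡ x) →
                       component i (centre C) ≡ component i ((point C j zero ⊕ point C j one) ⊕ point C j two)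
      same-component i (yes refl) = begin
        component x (centre C)                     ≡⟨ component-single-same x _ ⟩
        orbit (labelling x ⟨ zero , zero , C ⟩)   ≡⟨ cong orbit (sym vanishing-row-constant) ⟩
        orbit (base x)                             ≡⟨ sym (orbitSum-flat (base x)) ⟩
        orbitSum (base x) zero                     ≡⟨ cong (orbitSum (base x)) (sym (row-x-vanishes w)) ⟩
        orbitSum (base x) (slope x)                ≡⟨ sym (component-troika-sum C x j) ⟩
        component x ((point C j zero ⊕ point C j one) ⊕ point C j two) ∎
        where open ≡-Reasoning
      same-component i (no i≢x) = begin
        component i (centre C)                     ≡⟨ component-single-other i x _ i≢x ⟩
        0ₚ                                         ≡⟨ sym (orbitSum-steep (base i) (slope i) (i≢x ∘ only-row-x-vanishes i)) ⟩
        orbitSum (base i) (slope i)                ≡⟨ sym (component-troika-sum C i j) ⟩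
        component i ((point C j zero ⊕ point C j one) ⊕ point C j two) ∎
        where open ≡-Reasoning

    centre∈PV : ∀ C → PV x (centre C)
    centre∈PV C = single∈PV x (orbit (labelling x ⟨ zero , zero , C ⟩)) (orbit-nonzero (labelling x ⟨ zero , zero , C ⟩))

    centres-on-PV : ∀ C → set3 (centre C) (centre (C +₃ one)) (centre (C +₃ two)) ≐ PV x
    centres-on-PV C = ⊆PV , PV⊆
      where
      ⊆PV : set3 (centre C) (centre (C +₃ one)) (centre (C +₃ two)) ⊆ PV x
      ⊆PV (inj₁ refl)        = centre∈PV C
      ⊆PV (inj₂ (inj₁ refl)) = centre∈PV (C +₃ one)
      ⊆PV (inj₂ (inj₂ refl)) = centre∈PV (C +₃ two)

      a-centre : ∀ v → v ≡ labelling x ⟨ zero , zero , C ⟩ ⊎ v ≡ labelling x ⟨ zero , zero , C +₃ one ⟩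
                              ⊎ v ≡ labelling x ⟨ zero , zero , C +₃ two ⟩ →
                 set3 (centre C) (centre (C +₃ one)) (centre (C +₃ two)) (single x (orbit v))
      a-centre v (inj₁ v≡)        = inj₁ (cong (single x ∘ orbit) v≡)
      a-centre v (inj₂ (inj₁ v≡)) = inj₂ (inj₁ (cong (single x ∘ orbit) v≡))
      a-centre v (inj₂ (inj₂ v≡)) = inj₂ (inj₂ (cong (single x ∘ orbit) v≡))

      PV⊆ : PV x ⊆ set3 (centre C) (centre (C +₃ one)) (centre (C +₃ two))
      PV⊆ {y} y∈ =
        let y≡ , nonzero = PV⇒single x y y∈
            v = label (component x y)
        in  subst (set3 (centre C) (centre (C +₃ one)) (centre (C +₃ two)))
                  (sym (trans y≡ (cong (single x) (sym (orbit-label (component x y) nonzero)))))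
                  (a-centre v (affine-vertical-onto (labelling x) C v))

    centres-line : ∀ C → let S = set3 (centre C) (centre (C +₃ one)) (centre (C +₃ two)) in
                   S ≐ PVa ⊎ S ≐ PVb ⊎ S ≐ PVc ⊎ S ≐ PVd
    centres-line C = PV-cases x (centres-on-PV C)

    troika-split : ∀ C {F : Subset8} → F ≐ planeFan (π C) → TroikaSplit φ F (troika C zero) (troika C one) (troika C two)
    troika-split C F≐ = troika-troika C zero , troika-troika C one , troika-troika C two , ≐-trans F≐ (plane-split C)

    fan-centre : ∀ C {F : Subset8} → F ≐ planeFan (π C) → FanCentre φ F (centre C)
    fan-centre C F≐ = troika C zero , troika C one , troika C two , troika-split C F≐ ,
                      troika-centre C zero , troika-centre C one , troika-centre C two

    troika-split-unique : ∀ C {F : Subset8} → F ≐ planeFan (π C) → ∀ T T′ T″ → TroikaSplit φ F T T′ T″ →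
                          SameTriple T T′ T″ (troika C zero) (troika C one) (troika C two)
    troika-split-unique C {F} F≐ T T′ T″ (troika-T , troika-T′ , troika-T″ , F≐T∪) =
      (in-troikas T T⊆F troika-T , in-troikas T′ T′⊆F troika-T′ , in-troikas T″ T″⊆F troika-T″) ,
      (among zero , among one , among two)
      where
      T⊆F : T ⊆ F
      T⊆F y∈ = proj₂ F≐T∪ (inj₁ y∈)
      T′⊆F : T′ ⊆ F
      T′⊆F y∈ = proj₂ F≐T∪ (inj₂ (inj₁ y∈))
      T″⊆F : T″ ⊆ F
      T″⊆F y∈ = proj₂ F≐T∪ (inj₂ (inj₂ y∈))

      line-of : ∀ X → X ⊆ F → Troika φ X → Σ F3 λ j → X ≐ troika C j
      line-of X X⊆F troika-X = troika-in-plane C X troika-X (proj₁ F≐ ∘ X⊆F)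

      in-troika : ∀ X j → X ≐ troika C j → InTriple X (troika C zero) (troika C one) (troika C two)
      in-troika X zero             X≐ = inj₁ X≐
      in-troika X (suc zero)       X≐ = inj₂ (inj₁ X≐)
      in-troika X (suc (suc zero)) X≐ = inj₂ (inj₂ X≐)

      in-troikas : ∀ X → X ⊆ F → Troika φ X → InTriple X (troika C zero) (troika C one) (troika C two)
      in-troikas X X⊆F troika-X = let j , X≐ = line-of X X⊆F troika-X in in-troika X j X≐

      through-first-point : ∀ j X → X ⊆ F → Troika φ X → X (point C j zero) → troika C j ≐ X
      through-first-point j X X⊆F troika-X first∈X =
        let j′ , X≐ = line-of X X⊆F troika-X
            m , first≡ = troika⇒point C j′ (proj₁ X≐ first∈X)
        in  subst (λ j″ → troika C j″ ≐ X) (sym (proj₁ (point-injective C j zero j′ m first≡))) (≐-sym X≐)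

      among′ : ∀ j → (T ∪ (T′ ∪ T″)) (point C j zero) → InTriple (troika C j) T T′ T″
      among′ j (inj₁ ∈T)         = inj₁ (through-first-point j T T⊆F troika-T ∈T)
      among′ j (inj₂ (inj₁ ∈T′)) = inj₂ (inj₁ (through-first-point j T′ T′⊆F troika-T′ ∈T′))
      among′ j (inj₂ (inj₂ ∈T″)) = inj₂ (inj₂ (through-first-point j T″ T″⊆F troika-T″ ∈T″))

      among : ∀ j → InTriple (troika C j) T T′ T″
      among j = among′ j (proj₁ F≐T∪ (proj₂ F≐ (point∈plane C j zero)))

    parallel-fans : ∀ C {F : Subset8} → F ≐ planeFan (π C) →
                    Segre φ ≐ (F ∪ (planeFan (π (C +₃ one)) ∪ planeFan (π (C +₃ two))))
    parallel-fans C {F} F≐ = cover , covered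
      where
      place : ∀ g → OnPlane (π C) g ⊎ OnPlane (π (C +₃ one)) g ⊎ OnPlane (π (C +₃ two)) g →
              (F ∪ (planeFan (π (C +₃ one)) ∪ planeFan (π (C +₃ two)))) (pt g)
      place g (inj₁ g∈π)        = inj₁ (proj₂ F≐ (g , g∈π , refl))
      place g (inj₂ (inj₁ g∈π)) = inj₂ (inj₁ (g , g∈π , refl))
      place g (inj₂ (inj₂ g∈π)) = inj₂ (inj₂ (g , g∈π , refl))

      cover : Segre φ ⊆ (F ∪ (planeFan (π (C +₃ one)) ∪ planeFan (π (C +₃ two))))
      cover y∈S = let g , y≡ = segre⇒pt y∈S
                  in  subst (F ∪ (planeFan (π (C +₃ one)) ∪ planeFan (π (C +₃ two)))) (sym y≡)
                            (place g (parallel-planes-cover (π C) g))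

      covered : (F ∪ (planeFan (π (C +₃ one)) ∪ planeFan (π (C +₃ two)))) ⊆ Segre φ
      covered (inj₁ y∈F)        = planeFan⊆segre (π C) (proj₁ F≐ y∈F)
      covered (inj₂ (inj₁ y∈π)) = planeFan⊆segre (π (C +₃ one)) y∈π
      covered (inj₂ (inj₂ y∈π)) = planeFan⊆segre (π (C +₃ two)) y∈π

    parallel-fans-unique : ∀ C {F : Subset8} → F ≐ planeFan (π C) →
                           ∀ G′ G″ → Fan φ G′ → Fan φ G″ → Segre φ ≐ (F ∪ (G′ ∪ G″)) →
                           SameTriple F G′ G″ F (planeFan (π (C +₃ one))) (planeFan (π (C +₃ two)))
    parallel-fans-unique C {F} F≐ G′ G″ fan′ fan″ S≐ =
      arrange π₁ π₂ G′≐ G″≐ (parallel-planes-unique (π C) π₁ π₂ (λ g → on-planes g (proj₁ S≐ (pt∈segre g))))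
      where
      π₁ = proj₁ (fan-plane G′ fan′)
      π₂ = proj₁ (fan-plane G″ fan″)
      G′≐ = proj₂ (fan-plane G′ fan′)
      G″≐ = proj₂ (fan-plane G″ fan″)

      on-planes : ∀ g → (F ∪ (G′ ∪ G″)) (pt g) → OnPlane (π C) g ⊎ OnPlane π₁ g ⊎ OnPlane π₂ g
      on-planes g (inj₁ ∈F)         = inj₁ (planeFan⇒on-plane (π C) g (proj₁ F≐ ∈F))
      on-planes g (inj₂ (inj₁ ∈G′)) = inj₂ (inj₁ (planeFan⇒on-plane π₁ g (proj₁ G′≐ ∈G′)))
      on-planes g (inj₂ (inj₂ ∈G″)) = inj₂ (inj₂ (planeFan⇒on-plane π₂ g (proj₁ G″≐ ∈G″)))

      arrange : ∀ π₁ π₂ → G′ ≐ planeFan π₁ → G″ ≐ planeFan π₂ →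
                (π₁ ≡ π (C +₃ one) × π₂ ≡ π (C +₃ two)) ⊎ (π₁ ≡ π (C +₃ two) × π₂ ≡ π (C +₃ one)) →
                SameTriple F G′ G″ F (planeFan (π (C +₃ one))) (planeFan (π (C +₃ two)))
      arrange _ _ G′≐ G″≐ (inj₁ (refl , refl)) =
        (inj₁ ≐-refl , inj₂ (inj₁ G′≐) , inj₂ (inj₂ G″≐)) ,
        (inj₁ ≐-refl , inj₂ (inj₁ (≐-sym G′≐)) , inj₂ (inj₂ (≐-sym G″≐)))
      arrange _ _ G′≐ G″≐ (inj₂ (refl , refl)) =
        (inj₁ ≐-refl , inj₂ (inj₂ G′≐) , inj₂ (inj₁ G″≐)) ,
        (inj₁ ≐-refl , inj₂ (inj₂ (≐-sym G″≐)) , inj₂ (inj₁ (≐-sym G′≐)))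

theorem10 : (φ : Tensor → V8) → LinIso φ → Segre φ ⊆ ω4 →
    (F : Subset8) → Fan φ F →
    (Σ[ t ∈ Subset8 ] Σ[ t′ ∈ Subset8 ] Σ[ t″ ∈ Subset8 ]
      (TroikaSplit φ F t t′ t″ ×
       ((s s′ s″ : Subset8) → TroikaSplit φ F s s′ s″ → SameTriple s s′ s″ t t′ t″) ×
       Σ[ c ∈ V8 ] (IsCentre t c × IsCentre t′ c × IsCentre t″ c)))
    ×
    (Σ[ F′ ∈ Subset8 ] Σ[ F″ ∈ Subset8 ]
      (Fan φ F′ × Fan φ F″ × Segre φ ≐ (F ∪ (F′ ∪ F″)) ×
       ((G′ G″ : Subset8) → Fan φ G′ → Fan φ G″ → Segre φ ≐ (F ∪ (G′ ∪ G″)) →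
          SameTriple F G′ G″ F F′ F″) ×
       Σ[ c ∈ V8 ] Σ[ c′ ∈ V8 ] Σ[ c″ ∈ V8 ]
         (FanCentre φ F c × FanCentre φ F′ c′ × FanCentre φ F″ c″ ×
          (set3 c c′ c″ ≐ PVa ⊎ set3 c c′ c″ ≐ PVb ⊎ set3 c c′ c″ ≐ PVc ⊎ set3 c c′ c″ ≐ PVd))))
theorem10 φ (φ-linear , φ-bijective) segre⊆ω4 F fan =
  let (s , t , C) , F≐ = fan-plane F fan
      open ParallelPlanes s t
  in  ( troika C zero , troika C one , troika C two
      , troika-split C F≐ , troika-split-unique C F≐
      , centre C , troika-centre C zero , troika-centre C one , troika-centre C two )
    , ( planeFan (π (C +₃ one)) , planeFan (π (C +₃ two))
      , planeFan-fan (π (C +₃ one)) , planeFan-fan (π (C +₃ two))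
      , parallel-fans C F≐ , parallel-fans-unique C F≐
      , centre C , centre (C +₃ one) , centre (C +₃ two)
      , fan-centre C F≐ , fan-centre (C +₃ one) ≐-refl , fan-centre (C +₃ two) ≐-refl
      , centres-line C )
  where open Embedding φ φ-linear φ-bijective segre⊆ω4
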